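{- The theory $\mathsf{PA}^-$ interprets the theory $\mathsf{FUTC}_1$ via the translation $\theta$ described in the context; that is, for every sentence $\psi$ of the language of $\mathsf{FUTC}_1$, if $\mathsf{FUTC}_1\vdash\psi$ then $\mathsf{PA}^-\vdash\psi^\theta$.
   Context: $\mathsf{PA}^-$ is the first-order theory, in the language $0,1,+,\times,\leq$, of the non-negative parts of discretely ordered commutative rings (axioms: commutative semiring laws, $\leq$ a linear order, $x+1\not\leq x$, $y\leq x\to(y=x\vee y+1\leq x)$, monotonicity $y\leq x\to y+z\leq x+z$ and $y\leq x\to yz\leq xz$, and subtraction $y\leq x\to\exists z\,x=y+z$). $\mathsf{FUTC}_1$ is a two-sorted theory with an object sort $\mathfrak o$ and a string sort $\mathfrak s$ (variables $x,y,\dots$ for objects, $\alpha,\beta,\dots$ for strings), a constant $\oslash$ of sort $\mathfrak s$, a unary function $[\cdot]$ from $\mathfrak o$ to $\mathfrak s$, a binary function $\star$ on $\mathfrak s$, and a function $F$ from $\mathfrak s$ to $\mathfrak o$, with axioms: (1) $\oslash\star\alpha=\alpha\wedge\alpha\star\oslash=\alpha$; (2) $\alpha\star\beta=\oslash\to(\alpha=\oslash\wedge\beta=\oslash)$; (3) $(\alpha\star\beta)\star\gamma=\alpha\star(\beta\star\gamma)$; (4) $[x]$ is an atom, i.e. $[x]\neq\oslash$ and for all $\alpha,\beta$, $\alpha\star\beta=[x]\to(\alpha=\oslash\vee\beta=\oslash)$; (5) $[x]=[y]\to x=y$; (6) (Editors) $\alpha\star\beta=\gamma\star\delta\to\exists\eta\,((\alpha\star\eta=\gamma\wedge\beta=\eta\star\delta)\vee(\alpha=\gamma\star\eta\wedge\eta\star\beta=\delta))$;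 (7) $F(\alpha)=F(\beta)\to\alpha=\beta$. The translation $\theta$: the object sort is interpreted as all numbers with identity as equality; the string sort is interpreted as the quadruples $(a,b,c,d)$ (thought of as $2\times2$ matrices $\begin{pmatrix}a&b\\c&d\end{pmatrix}$) satisfying $ad=bc+1\wedge((b=0\wedge c=0)\vee(a\leq c\wedge b\leq d))$, with componentwise equality; $\oslash$ is interpreted as the identity matrix $(1,0,0,1)$; $[n]$ is interpreted as $\begin{pmatrix}1&n\\1&n+1\end{pmatrix}$; $\star$ is interpreted as matrix multiplication; $F(a,b,c,d):=\langle a,\langle b,\langle c,d\rangle\rangle\rangle$ where $\langle x,y\rangle:=(x+y)^2+x$. Quantifiers are relativised to these domains. -}

module Defs where

open import Data.List using (List; []; _∷_)
open import Data.List.Membership.Propositional using ()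
open import Data.Unit using (⊤; tt)
open import Data.Product using (_×_; _,_)

record Signature : Set₁ where
  field
    Sort : Set
    Func : List Sort → Sort → Set
    Rel  : List Sort → Set

module Syntax (L : Signature) where
  open Signature L

  infix 4 _∋_
  data _∋_ : List Sort → Sort → Set where
    here  : ∀ {Γ σ} → (σ ∷ Γ) ∋ σ
    there : ∀ {Γ σ τ} → Γ ∋ σ → (τ ∷ Γ) ∋ σ

  mutual
    data Term (Γ : List Sort) : Sort → Set where
      var : ∀ {σ} → Γ ∋ σ → Term Γ σ
      app : ∀ {as σ} → Func as σ → Terms Γ as → Term Γ σ

    data Terms (Γ : List Sort) : List Sort → Set where
      nil  : Terms Γ []
      _∷ₜ_ : ∀ {σ as} → Term Γ σ → Terms Γ as → Terms Γ (σ ∷ as)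

  infixr 5 _∷ₜ_
  infix  4 _≐_
  infixr 3 _∧'_
  infixr 2 _∨'_
  infixr 1 _⇒_

  data Formula (Γ : List Sort) : Set where
    ⊥'   : Formula Γ
    _≐_  : ∀ {σ} → Term Γ σ → Term Γ σ → Formula Γ
    rel  : ∀ {as} → Rel as → Terms Γ as → Formula Γ
    _⇒_  : Formula Γ → Formula Γ → Formula Γ
    _∧'_ : Formula Γ → Formula Γ → Formula Γ
    _∨'_ : Formula Γ → Formula Γ → Formula Γ
    all  : (σ : Sort) → Formula (σ ∷ Γ) → Formula Γ
    ex   : (σ : Sort) → Formula (σ ∷ Γ) → Formula Γ

  ¬' : ∀ {Γ} → Formula Γ → Formula Γ
  ¬' φ = φ ⇒ ⊥'

  Sentence : Set
  Sentence = Formula []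

  Ren : List Sort → List Sort → Set
  Ren Γ Δ = ∀ {σ} → Γ ∋ σ → Δ ∋ σ

  liftR : ∀ {Γ Δ τ} → Ren Γ Δ → Ren (τ ∷ Γ) (τ ∷ Δ)
  liftR ρ here      = here
  liftR ρ (there x) = there (ρ x)

  mutual
    renT : ∀ {Γ Δ σ} → Ren Γ Δ → Term Γ σ → Term Δ σ
    renT ρ (var x)    = var (ρ x)
    renT ρ (app f ts) = app f (renTs ρ ts)

    renTs : ∀ {Γ Δ as} → Ren Γ Δ → Terms Γ as → Terms Δ as
    renTs ρ nil       = nil
    renTs ρ (t ∷ₜ ts) = renT ρ t ∷ₜ renTs ρ ts

  renF : ∀ {Γ Δ} → Ren Γ Δ → Formula Γ → Formula Δ
  renF ρ ⊥'         = ⊥'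
  renF ρ (t ≐ u)    = renT ρ t ≐ renT ρ u
  renF ρ (rel r ts) = rel r (renTs ρ ts)
  renF ρ (φ ⇒ ψ)    = renF ρ φ ⇒ renF ρ ψ
  renF ρ (φ ∧' ψ)   = renF ρ φ ∧' renF ρ ψ
  renF ρ (φ ∨' ψ)   = renF ρ φ ∨' renF ρ ψ
  renF ρ (all σ φ)  = all σ (renF (liftR ρ) φ)
  renF ρ (ex σ φ)   = ex σ (renF (liftR ρ) φ)

  Sub : List Sort → List Sort → Set
  Sub Γ Δ = ∀ {σ} → Γ ∋ σ → Term Δ σ

  liftS : ∀ {Γ Δ τ} → Sub Γ Δ → Sub (τ ∷ Γ) (τ ∷ Δ)
  liftS s here      = var here
  liftS s (there x) = renT there (s x)

  mutual
    subT : ∀ {Γ Δ σ} → Sub Γ Δ → Term Γ σ → Term Δ σ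
    subT s (var x)    = s x
    subT s (app f ts) = app f (subTs s ts)

    subTs : ∀ {Γ Δ as} → Sub Γ Δ → Terms Γ as → Terms Δ as
    subTs s nil       = nil
    subTs s (t ∷ₜ ts) = subT s t ∷ₜ subTs s ts

  subF : ∀ {Γ Δ} → Sub Γ Δ → Formula Γ → Formula Δ
  subF s ⊥'         = ⊥'
  subF s (t ≐ u)    = subT s t ≐ subT s u
  subF s (rel r ts) = rel r (subTs s ts)
  subF s (φ ⇒ ψ)    = subF s φ ⇒ subF s ψ
  subF s (φ ∧' ψ)   = subF s φ ∧' subF s ψ
  subF s (φ ∨' ψ)   = subF s φ ∨' subF s ψ
  subF s (all σ φ)  = all σ (subF (liftS s) φ)
  subF s (ex σ φ)   = ex σ (subF (liftS s) φ)

  sub0 : ∀ {Γ σ} → Term Γ σ → Sub (σ ∷ Γ) Γ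
  sub0 t here      = t
  sub0 t (there x) = var x

  _[_] : ∀ {Γ σ} → Formula (σ ∷ Γ) → Term Γ σ → Formula Γ
  φ [ t ] = subF (sub0 t) φ

  wkF : ∀ {Γ τ} → Formula Γ → Formula (τ ∷ Γ)
  wkF = renF there

  wkHyps : ∀ {Γ τ} → List (Formula Γ) → List (Formula (τ ∷ Γ))
  wkHyps []       = []
  wkHyps (φ ∷ Δ) = wkF φ ∷ wkHyps Δ

  closeF : ∀ {Γ} → Sentence → Formula Γ
  closeF = renF (λ ())

  infix 4 _∈h_
  data _∈h_ {Γ : List Sort} (φ : Formula Γ) : List (Formula Γ) → Set where
    hd : ∀ {Δ} → φ ∈h (φ ∷ Δ)
    tl : ∀ {ψ Δ} → φ ∈h Δ → φ ∈h (ψ ∷ Δ)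

  Theory : Set₁
  Theory = Sentence → Set

  -- Classical natural deduction with equality, relative to a theory T.
  -- Γ : context of free (sorted) variables, Δ : open hypotheses.
  data Deriv (T : Theory) (Γ : List Sort) (Δ : List (Formula Γ)) : Formula Γ → Set where
    hyp   : ∀ {φ} → φ ∈h Δ → Deriv T Γ Δ φ
    axm   : ∀ {φ} → T φ → Deriv T Γ Δ (closeF φ)
    ⊥E    : ∀ {φ} → Deriv T Γ Δ ⊥' → Deriv T Γ Δ φ
    raa   : ∀ {φ} → Deriv T Γ (¬' φ ∷ Δ) ⊥' → Deriv T Γ Δ φ
    ⇒I    : ∀ {φ ψ} → Deriv T Γ (φ ∷ Δ) ψ → Deriv T Γ Δ (φ ⇒ ψ)
    ⇒E    : ∀ {φ ψ} → Deriv T Γ Δ (φ ⇒ ψ) → Deriv T Γ Δ φ → Deriv T Γ Δ ψ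
    ∧I    : ∀ {φ ψ} → Deriv T Γ Δ φ → Deriv T Γ Δ ψ → Deriv T Γ Δ (φ ∧' ψ)
    ∧E₁   : ∀ {φ ψ} → Deriv T Γ Δ (φ ∧' ψ) → Deriv T Γ Δ φ
    ∧E₂   : ∀ {φ ψ} → Deriv T Γ Δ (φ ∧' ψ) → Deriv T Γ Δ ψ
    ∨I₁   : ∀ {φ ψ} → Deriv T Γ Δ φ → Deriv T Γ Δ (φ ∨' ψ)
    ∨I₂   : ∀ {φ ψ} → Deriv T Γ Δ ψ → Deriv T Γ Δ (φ ∨' ψ)
    ∨E    : ∀ {φ ψ χ} → Deriv T Γ Δ (φ ∨' ψ) → Deriv T Γ (φ ∷ Δ) χ
          → Deriv T Γ (ψ ∷ Δ) χ → Deriv T Γ Δ χ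
    ∀I    : ∀ {σ φ} → Deriv T (σ ∷ Γ) (wkHyps Δ) φ → Deriv T Γ Δ (all σ φ)
    ∀E    : ∀ {σ φ} → Deriv T Γ Δ (all σ φ) → (t : Term Γ σ) → Deriv T Γ Δ (φ [ t ])
    ∃I    : ∀ {σ φ} → (t : Term Γ σ) → Deriv T Γ Δ (φ [ t ]) → Deriv T Γ Δ (ex σ φ)
    ∃E    : ∀ {σ φ ψ} → Deriv T Γ Δ (ex σ φ) → Deriv T (σ ∷ Γ) (φ ∷ wkHyps Δ) (wkF ψ)
          → Deriv T Γ Δ ψ
    ≐refl : ∀ {σ} (t : Term Γ σ) → Deriv T Γ Δ (t ≐ t)
    ≐subst : ∀ {σ} {t u : Term Γ σ} (φ : Formula (σ ∷ Γ))
          → Deriv T Γ Δ (t ≐ u) → Deriv T Γ Δ (φ [ t ]) → Deriv T Γ Δ (φ [ u ])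

  infix 3 _⊢_
  _⊢_ : Theory → Sentence → Set
  T ⊢ ψ = Deriv T [] [] ψ

data PAFunc : List ⊤ → ⊤ → Set where
  zero' one'  : PAFunc [] tt
  plus times  : PAFunc (tt ∷ tt ∷ []) tt

data PARel : List ⊤ → Set where
  leq : PARel (tt ∷ tt ∷ [])

PASig : Signature
PASig = record { Sort = ⊤ ; Func = PAFunc ; Rel = PARel }

module PA = Syntax PASig
open PA using (here; there; var; app; nil; _∷ₜ_; _≐_; rel; ⊥'; _⇒_; _∧'_; _∨'_; all; ex; ¬')

PTerm : List ⊤ → Set
PTerm Γ = PA.Term Γ tt

PFormula : List ⊤ → Set
PFormula = PA.Formula

infixl 6 _⊕_
infixl 7 _⊗_
infix  4 _≼_

𝟘 𝟙 : ∀ {Γ} → PTerm Γ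
𝟘 = app zero' nil
𝟙 = app one' nil

_⊕_ _⊗_ : ∀ {Γ} → PTerm Γ → PTerm Γ → PTerm Γ
t ⊕ u = app plus (t ∷ₜ u ∷ₜ nil)
t ⊗ u = app times (t ∷ₜ u ∷ₜ nil)

_≼_ : ∀ {Γ} → PTerm Γ → PTerm Γ → PFormula Γ
t ≼ u = rel leq (t ∷ₜ u ∷ₜ nil)

∀ₚ ∃ₚ : ∀ {Γ} → PFormula (tt ∷ Γ) → PFormula Γ
∀ₚ = all tt
∃ₚ = ex tt

-- de Bruijn variables (p0 = innermost bound variable)
p0 : ∀ {Γ} → PTerm (tt ∷ Γ)
p0 = var here
p1 : ∀ {Γ} → PTerm (tt ∷ tt ∷ Γ)
p1 = var (there here)
p2 : ∀ {Γ} → PTerm (tt ∷ tt ∷ tt ∷ Γ)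
p2 = var (there (there here))
p3 : ∀ {Γ} → PTerm (tt ∷ tt ∷ tt ∷ tt ∷ Γ)
p3 = var (there (there (there here)))

-- Axioms of PA⁻.  In "∀x∀y∀z", x = p2, y = p1, z = p0; in "∀x∀y", x = p1, y = p0.
data PAminus : PA.Sentence → Set where
  add-assoc  : PAminus (∀ₚ (∀ₚ (∀ₚ ((p2 ⊕ p1) ⊕ p0 ≐ p2 ⊕ (p1 ⊕ p0)))))
  add-comm   : PAminus (∀ₚ (∀ₚ (p1 ⊕ p0 ≐ p0 ⊕ p1)))
  add-zero   : PAminus (∀ₚ (p0 ⊕ 𝟘 ≐ p0))
  mul-assoc  : PAminus (∀ₚ (∀ₚ (∀ₚ ((p2 ⊗ p1) ⊗ p0 ≐ p2 ⊗ (p1 ⊗ p0)))))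
  mul-comm   : PAminus (∀ₚ (∀ₚ (p1 ⊗ p0 ≐ p0 ⊗ p1)))
  mul-one    : PAminus (∀ₚ (p0 ⊗ 𝟙 ≐ p0))
  mul-zero   : PAminus (∀ₚ (p0 ⊗ 𝟘 ≐ 𝟘))
  distrib    : PAminus (∀ₚ (∀ₚ (∀ₚ (p2 ⊗ (p1 ⊕ p0) ≐ p2 ⊗ p1 ⊕ p2 ⊗ p0))))
  le-refl    : PAminus (∀ₚ (p0 ≼ p0))
  le-antisym : PAminus (∀ₚ (∀ₚ (p1 ≼ p0 ∧' p0 ≼ p1 ⇒ p1 ≐ p0)))
  le-trans   : PAminus (∀ₚ (∀ₚ (∀ₚ (p2 ≼ p1 ∧' p1 ≼ p0 ⇒ p2 ≼ p0))))
  le-total   : PAminus (∀ₚ (∀ₚ (p1 ≼ p0 ∨' p0 ≼ p1)))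
  succ-nle   : PAminus (∀ₚ (¬' (p0 ⊕ 𝟙 ≼ p0)))
  discrete   : PAminus (∀ₚ (∀ₚ (p0 ≼ p1 ⇒ (p0 ≐ p1 ∨' p0 ⊕ 𝟙 ≼ p1))))
  mono-add   : PAminus (∀ₚ (∀ₚ (∀ₚ (p1 ≼ p2 ⇒ p1 ⊕ p0 ≼ p2 ⊕ p0))))
  mono-mul   : PAminus (∀ₚ (∀ₚ (∀ₚ (p1 ≼ p2 ⇒ p1 ⊗ p0 ≼ p2 ⊗ p0))))
  subtract   : PAminus (∀ₚ (∀ₚ (p0 ≼ p1 ⇒ ∃ₚ (p2 ≐ p1 ⊕ p0))))

data FSort : Set where
  𝔬 𝔰 : FSort

data FFunc : List FSort → FSort → Set where
  emp  : FFunc [] 𝔰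
  atom : FFunc (𝔬 ∷ []) 𝔰
  star : FFunc (𝔰 ∷ 𝔰 ∷ []) 𝔰
  Fn   : FFunc (𝔰 ∷ []) 𝔬

data FRel : List FSort → Set where

FUTCSig : Signature
FUTCSig = record { Sort = FSort ; Func = FFunc ; Rel = FRel }

module FU = Syntax FUTCSig

FTerm : List FSort → FSort → Set
FTerm = FU.Term

⊘ : ∀ {Γ} → FTerm Γ 𝔰
⊘ = FU.app emp FU.nil

[_] : ∀ {Γ} → FTerm Γ 𝔬 → FTerm Γ 𝔰
[ t ] = FU.app atom (t FU.∷ₜ FU.nil)

infixl 7 _⋆_
_⋆_ : ∀ {Γ} → FTerm Γ 𝔰 → FTerm Γ 𝔰 → FTerm Γ 𝔰
t ⋆ u = FU.app star (t FU.∷ₜ u FU.∷ₜ FU.nil)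

Fₜ : ∀ {Γ} → FTerm Γ 𝔰 → FTerm Γ 𝔬
Fₜ t = FU.app Fn (t FU.∷ₜ FU.nil)

f0 : ∀ {Γ σ} → FTerm (σ ∷ Γ) σ
f0 = FU.var FU.here
f1 : ∀ {Γ σ τ} → FTerm (τ ∷ σ ∷ Γ) σ
f1 = FU.var (FU.there FU.here)
f2 : ∀ {Γ σ τ₁ τ₂} → FTerm (τ₂ ∷ τ₁ ∷ σ ∷ Γ) σ
f2 = FU.var (FU.there (FU.there FU.here))
f3 : ∀ {Γ σ τ₁ τ₂ τ₃} → FTerm (τ₃ ∷ τ₂ ∷ τ₁ ∷ σ ∷ Γ) σ
f3 = FU.var (FU.there (FU.there (FU.there FU.here)))
f4 : ∀ {Γ σ τ₁ τ₂ τ₃ τ₄} → FTerm (τ₄ ∷ τ₃ ∷ τ₂ ∷ τ₁ ∷ σ ∷ Γ) σ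
f4 = FU.var (FU.there (FU.there (FU.there (FU.there FU.here))))

data FUTC₁ : FU.Sentence → Set where
  ax1 : FUTC₁ (FU.all 𝔰 ((⊘ ⋆ f0 FU.≐ f0) FU.∧' (f0 ⋆ ⊘ FU.≐ f0)))
  -- (2) ∀α∀β (α⋆β = ⊘ → α = ⊘ ∧ β = ⊘)     [α = f1, β = f0]
  ax2 : FUTC₁ (FU.all 𝔰 (FU.all 𝔰
          ((f1 ⋆ f0 FU.≐ ⊘) FU.⇒ ((f1 FU.≐ ⊘) FU.∧' (f0 FU.≐ ⊘)))))
  -- (3) ∀α∀β∀γ (α⋆β)⋆γ = α⋆(β⋆γ)            [α = f2, β = f1, γ = f0]
  ax3 : FUTC₁ (FU.all 𝔰 (FU.all 𝔰 (FU.all 𝔰 ((f2 ⋆ f1) ⋆ f0 FU.≐ f2 ⋆ (f1 ⋆ f0)))))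
  ax4 : FUTC₁ (FU.all 𝔬
          (FU.¬' ([ f0 ] FU.≐ ⊘)
           FU.∧' FU.all 𝔰 (FU.all 𝔰
                   ((f1 ⋆ f0 FU.≐ [ f2 ]) FU.⇒ ((f1 FU.≐ ⊘) FU.∨' (f0 FU.≐ ⊘))))))
  ax5 : FUTC₁ (FU.all 𝔬 (FU.all 𝔬 (([ f1 ] FU.≐ [ f0 ]) FU.⇒ (f1 FU.≐ f0))))
  -- (6) Editors: ∀α∀β∀γ∀δ (α⋆β = γ⋆δ →
  --        ∃η ((α⋆η = γ ∧ β = η⋆δ) ∨ (α = γ⋆η ∧ η⋆β = δ)))
  --     outside ∃η: α = f3, β = f2, γ = f1, δ = f0; inside: α = f4, β = f3, γ = f2, δ = f1, η = f0
  ax6 : FUTC₁ (FU.all 𝔰 (FU.all 𝔰 (FU.all 𝔰 (FU.all 𝔰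
          ((f3 ⋆ f2 FU.≐ f1 ⋆ f0) FU.⇒
            FU.ex 𝔰 (((f4 ⋆ f0 FU.≐ f2) FU.∧' (f3 FU.≐ f0 ⋆ f1))
                     FU.∨' ((f4 FU.≐ f2 ⋆ f0) FU.∧' (f0 ⋆ f3 FU.≐ f1))))))))
  ax7 : FUTC₁ (FU.all 𝔰 (FU.all 𝔰 ((Fₜ f1 FU.≐ Fₜ f0) FU.⇒ (f1 FU.≐ f0))))

-- a string variable becomes four number variables a,b,c,d (bound in this order)
⟦_⟧ : List FSort → List ⊤
⟦ [] ⟧    = []
⟦ 𝔬 ∷ Γ ⟧ = tt ∷ ⟦ Γ ⟧
⟦ 𝔰 ∷ Γ ⟧ = tt ∷ tt ∷ tt ∷ tt ∷ ⟦ Γ ⟧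

-- a 2×2 matrix (a b ; c d) of PA⁻-terms
record Mat (Δ : List ⊤) : Set where
  constructor mat
  field a b c d : PTerm Δ

Tr : FSort → List ⊤ → Set
Tr 𝔬 Δ = PTerm Δ
Tr 𝔰 Δ = Mat Δ

renTr : ∀ {σ Δ Δ'} → PA.Ren Δ Δ' → Tr σ Δ → Tr σ Δ'
renTr {𝔬} ρ t            = PA.renT ρ t
renTr {𝔰} ρ (mat a b c d) = mat (PA.renT ρ a) (PA.renT ρ b) (PA.renT ρ c) (PA.renT ρ d)

trVar : ∀ {Γ σ} → Γ FU.∋ σ → Tr σ ⟦ Γ ⟧
trVar {𝔬 ∷ Γ} FU.here      = p0
trVar {𝔰 ∷ Γ} FU.here      = mat p3 p2 p1 p0
trVar {𝔬 ∷ Γ} (FU.there x) = renTr there (trVar x)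
trVar {𝔰 ∷ Γ} (FU.there x) = renTr (λ y → there (there (there (there y)))) (trVar x)

_·ₘ_ : ∀ {Δ} → Mat Δ → Mat Δ → Mat Δ
mat a b c d ·ₘ mat a' b' c' d' =
  mat (a ⊗ a' ⊕ b ⊗ c') (a ⊗ b' ⊕ b ⊗ d') (c ⊗ a' ⊕ d ⊗ c') (c ⊗ b' ⊕ d ⊗ d')

pair : ∀ {Δ} → PTerm Δ → PTerm Δ → PTerm Δ
pair x y = (x ⊕ y) ⊗ (x ⊕ y) ⊕ x

Fθ : ∀ {Δ} → Mat Δ → PTerm Δ
Fθ (mat a b c d) = pair a (pair b (pair c d))

trTerm : ∀ {Γ σ} → FTerm Γ σ → Tr σ ⟦ Γ ⟧
trTerm (FU.var x) = trVar x
trTerm (FU.app emp FU.nil) = mat 𝟙 𝟘 𝟘 𝟙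
trTerm (FU.app atom (t FU.∷ₜ FU.nil)) = mat 𝟙 (trTerm t) 𝟙 (trTerm t ⊕ 𝟙)
trTerm (FU.app star (t FU.∷ₜ u FU.∷ₜ FU.nil)) = trTerm t ·ₘ trTerm u
trTerm (FU.app Fn (t FU.∷ₜ FU.nil)) = Fθ (trTerm t)

Dom : ∀ {Δ} → Mat Δ → PFormula Δ
Dom (mat a b c d) = a ⊗ d ≐ b ⊗ c ⊕ 𝟙 ∧' ((b ≐ 𝟘 ∧' c ≐ 𝟘) ∨' (a ≼ c ∧' b ≼ d))

EqM : ∀ {Δ} → Mat Δ → Mat Δ → PFormula Δ
EqM (mat a b c d) (mat a' b' c' d') = a ≐ a' ∧' (b ≐ b' ∧' (c ≐ c' ∧' d ≐ d'))

θ : ∀ {Γ} → FU.Formula Γ → PFormula ⟦ Γ ⟧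
θ FU.⊥'                 = ⊥'
θ (FU._≐_ {𝔬} t u)      = trTerm t ≐ trTerm u
θ (FU._≐_ {𝔰} t u)      = EqM (trTerm t) (trTerm u)
θ (FU.rel () ts)
θ (φ FU.⇒ ψ)            = θ φ ⇒ θ ψ
θ (φ FU.∧' ψ)           = θ φ ∧' θ ψ
θ (φ FU.∨' ψ)           = θ φ ∨' θ ψ
θ (FU.all 𝔬 φ)          = ∀ₚ (θ φ)
θ (FU.all 𝔰 φ)          = ∀ₚ (∀ₚ (∀ₚ (∀ₚ (Dom (mat p3 p2 p1 p0) ⇒ θ φ))))
θ (FU.ex 𝔬 φ)           = ∃ₚ (θ φ)
θ (FU.ex 𝔰 φ)           = ∃ₚ (∃ₚ (∃ₚ (∃ₚ (Dom (mat p3 p2 p1 p0) ∧' θ φ))))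

{-# OPTIONS --safe #-}
module Submission where

-- Strings become the matrices (a b ; c d) of SL₂(ℕ) that are the identity or satisfy
-- a ≤ c and b ≤ d, with [n] = (1 n ; 1 n+1).  Derivations are translated rule by rule,
-- which needs θ to commute with weakening and substitution and PA⁻ to prove every
-- translated axiom.  Only Editors needs an idea.  Order column vectors by slope,
-- u ⊑ v iff u₂v₁ ≤ u₁v₂.  If AB = CD = M, the columns of M lie between the two columns
-- of A and between those of C; a Plücker identity forbids these two cones from
-- crossing, so one contains the other, say C's inside A's.  Then η = adj(A)·C has
-- natural entries (by PA⁻ subtraction), lies in the domain, and Aη = C, B = ηD.

open import Defs hiding ([_])

module SyntaxProperties (L : Signature) where

  open import Data.List using (List; _∷_)
  open import Data.Product using (Σ-syntax; _×_; _,_)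
  open import Relation.Binary.PropositionalEquality using (_≡_; refl; sym; trans; cong; cong₂; subst)
  open Signature L
  open Syntax L

  infix 4 _≗ᵣ_ _≗ₛ_

  _≗ᵣ_ : ∀ {Γ Δ} → Ren Γ Δ → Ren Γ Δ → Set
  _≗ᵣ_ {Γ} ρ ρ' = ∀ {σ} (x : Γ ∋ σ) → ρ x ≡ ρ' x

  _≗ₛ_ : ∀ {Γ Δ} → Sub Γ Δ → Sub Γ Δ → Set
  _≗ₛ_ {Γ} s s' = ∀ {σ} (x : Γ ∋ σ) → s x ≡ s' x

  liftR-cong : ∀ {Γ Δ τ} {ρ ρ' : Ren Γ Δ} → ρ ≗ᵣ ρ' → liftR {τ = τ} ρ ≗ᵣ liftR ρ'
  liftR-cong e here      = refl
  liftR-cong e (there x) = cong there (e x)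

  mutual
    renT-cong : ∀ {Γ Δ σ} {ρ ρ' : Ren Γ Δ} → ρ ≗ᵣ ρ' → (t : Term Γ σ) → renT ρ t ≡ renT ρ' t
    renT-cong e (var x)    = cong var (e x)
    renT-cong e (app f ts) = cong (app f) (renTs-cong e ts)

    renTs-cong : ∀ {Γ Δ as} {ρ ρ' : Ren Γ Δ} → ρ ≗ᵣ ρ' → (ts : Terms Γ as) → renTs ρ ts ≡ renTs ρ' ts
    renTs-cong e nil       = refl
    renTs-cong e (t ∷ₜ ts) = cong₂ _∷ₜ_ (renT-cong e t) (renTs-cong e ts)

  renF-cong : ∀ {Γ Δ} {ρ ρ' : Ren Γ Δ} → ρ ≗ᵣ ρ' → (φ : Formula Γ) → renF ρ φ ≡ renF ρ' φ
  renF-cong e ⊥'         = refl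
  renF-cong e (t ≐ u)    = cong₂ _≐_ (renT-cong e t) (renT-cong e u)
  renF-cong e (rel r ts) = cong (rel r) (renTs-cong e ts)
  renF-cong e (φ ⇒ ψ)    = cong₂ _⇒_ (renF-cong e φ) (renF-cong e ψ)
  renF-cong e (φ ∧' ψ)   = cong₂ _∧'_ (renF-cong e φ) (renF-cong e ψ)
  renF-cong e (φ ∨' ψ)   = cong₂ _∨'_ (renF-cong e φ) (renF-cong e ψ)
  renF-cong e (all σ φ)  = cong (all σ) (renF-cong (liftR-cong e) φ)
  renF-cong e (ex σ φ)   = cong (ex σ) (renF-cong (liftR-cong e) φ)

  liftS-cong : ∀ {Γ Δ τ} {s s' : Sub Γ Δ} → s ≗ₛ s' → liftS {τ = τ} s ≗ₛ liftS s'
  liftS-cong e here      = refl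
  liftS-cong e (there x) = cong (renT there) (e x)

  mutual
    subT-cong : ∀ {Γ Δ σ} {s s' : Sub Γ Δ} → s ≗ₛ s' → (t : Term Γ σ) → subT s t ≡ subT s' t
    subT-cong e (var x)    = e x
    subT-cong e (app f ts) = cong (app f) (subTs-cong e ts)

    subTs-cong : ∀ {Γ Δ as} {s s' : Sub Γ Δ} → s ≗ₛ s' → (ts : Terms Γ as) → subTs s ts ≡ subTs s' ts
    subTs-cong e nil       = refl
    subTs-cong e (t ∷ₜ ts) = cong₂ _∷ₜ_ (subT-cong e t) (subTs-cong e ts)

  subF-cong : ∀ {Γ Δ} {s s' : Sub Γ Δ} → s ≗ₛ s' → (φ : Formula Γ) → subF s φ ≡ subF s' φ
  subF-cong e ⊥'         = refl
  subF-cong e (t ≐ u)    = cong₂ _≐_ (subT-cong e t) (subT-cong e u)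
  subF-cong e (rel r ts) = cong (rel r) (subTs-cong e ts)
  subF-cong e (φ ⇒ ψ)    = cong₂ _⇒_ (subF-cong e φ) (subF-cong e ψ)
  subF-cong e (φ ∧' ψ)   = cong₂ _∧'_ (subF-cong e φ) (subF-cong e ψ)
  subF-cong e (φ ∨' ψ)   = cong₂ _∨'_ (subF-cong e φ) (subF-cong e ψ)
  subF-cong e (all σ φ)  = cong (all σ) (subF-cong (liftS-cong e) φ)
  subF-cong e (ex σ φ)   = cong (ex σ) (subF-cong (liftS-cong e) φ)

  mutual
    renT-renT : ∀ {Γ Δ Θ σ} (ρ : Ren Δ Θ) (ρ' : Ren Γ Δ) (t : Term Γ σ) →
                renT ρ (renT ρ' t) ≡ renT (λ x → ρ (ρ' x)) t
    renT-renT ρ ρ' (var x)    = refl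
    renT-renT ρ ρ' (app f ts) = cong (app f) (renTs-renTs ρ ρ' ts)

    renTs-renTs : ∀ {Γ Δ Θ as} (ρ : Ren Δ Θ) (ρ' : Ren Γ Δ) (ts : Terms Γ as) →
                  renTs ρ (renTs ρ' ts) ≡ renTs (λ x → ρ (ρ' x)) ts
    renTs-renTs ρ ρ' nil       = refl
    renTs-renTs ρ ρ' (t ∷ₜ ts) = cong₂ _∷ₜ_ (renT-renT ρ ρ' t) (renTs-renTs ρ ρ' ts)

  liftR-liftR : ∀ {Γ Δ Θ τ} (ρ : Ren Δ Θ) (ρ' : Ren Γ Δ) →
                (λ {σ} (x : (τ ∷ Γ) ∋ σ) → liftR ρ (liftR ρ' x)) ≗ᵣ liftR (λ x → ρ (ρ' x))
  liftR-liftR ρ ρ' here      = refl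
  liftR-liftR ρ ρ' (there x) = refl

  renF-renF : ∀ {Γ Δ Θ} (ρ : Ren Δ Θ) (ρ' : Ren Γ Δ) (φ : Formula Γ) →
              renF ρ (renF ρ' φ) ≡ renF (λ x → ρ (ρ' x)) φ
  renF-renF ρ ρ' ⊥'         = refl
  renF-renF ρ ρ' (t ≐ u)    = cong₂ _≐_ (renT-renT ρ ρ' t) (renT-renT ρ ρ' u)
  renF-renF ρ ρ' (rel r ts) = cong (rel r) (renTs-renTs ρ ρ' ts)
  renF-renF ρ ρ' (φ ⇒ ψ)    = cong₂ _⇒_ (renF-renF ρ ρ' φ) (renF-renF ρ ρ' ψ)
  renF-renF ρ ρ' (φ ∧' ψ)   = cong₂ _∧'_ (renF-renF ρ ρ' φ) (renF-renF ρ ρ' ψ)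
  renF-renF ρ ρ' (φ ∨' ψ)   = cong₂ _∨'_ (renF-renF ρ ρ' φ) (renF-renF ρ ρ' ψ)
  renF-renF ρ ρ' (all σ φ)  =
    cong (all σ) (trans (renF-renF (liftR ρ) (liftR ρ') φ) (renF-cong (liftR-liftR ρ ρ') φ))
  renF-renF ρ ρ' (ex σ φ)   =
    cong (ex σ) (trans (renF-renF (liftR ρ) (liftR ρ') φ) (renF-cong (liftR-liftR ρ ρ') φ))

  mutual
    subT-renT : ∀ {Γ Δ Θ σ} (s : Sub Δ Θ) (ρ : Ren Γ Δ) (t : Term Γ σ) →
                subT s (renT ρ t) ≡ subT (λ x → s (ρ x)) t
    subT-renT s ρ (var x)    = refl
    subT-renT s ρ (app f ts) = cong (app f) (subTs-renTs s ρ ts)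

    subTs-renTs : ∀ {Γ Δ Θ as} (s : Sub Δ Θ) (ρ : Ren Γ Δ) (ts : Terms Γ as) →
                  subTs s (renTs ρ ts) ≡ subTs (λ x → s (ρ x)) ts
    subTs-renTs s ρ nil       = refl
    subTs-renTs s ρ (t ∷ₜ ts) = cong₂ _∷ₜ_ (subT-renT s ρ t) (subTs-renTs s ρ ts)

  liftS-liftR : ∀ {Γ Δ Θ τ} (s : Sub Δ Θ) (ρ : Ren Γ Δ) →
                (λ {σ} (x : (τ ∷ Γ) ∋ σ) → liftS s (liftR ρ x)) ≗ₛ liftS (λ x → s (ρ x))
  liftS-liftR s ρ here      = refl
  liftS-liftR s ρ (there x) = refl

  subF-renF : ∀ {Γ Δ Θ} (s : Sub Δ Θ) (ρ : Ren Γ Δ) (φ : Formula Γ) →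
              subF s (renF ρ φ) ≡ subF (λ x → s (ρ x)) φ
  subF-renF s ρ ⊥'         = refl
  subF-renF s ρ (t ≐ u)    = cong₂ _≐_ (subT-renT s ρ t) (subT-renT s ρ u)
  subF-renF s ρ (rel r ts) = cong (rel r) (subTs-renTs s ρ ts)
  subF-renF s ρ (φ ⇒ ψ)    = cong₂ _⇒_ (subF-renF s ρ φ) (subF-renF s ρ ψ)
  subF-renF s ρ (φ ∧' ψ)   = cong₂ _∧'_ (subF-renF s ρ φ) (subF-renF s ρ ψ)
  subF-renF s ρ (φ ∨' ψ)   = cong₂ _∨'_ (subF-renF s ρ φ) (subF-renF s ρ ψ)
  subF-renF s ρ (all σ φ)  =
    cong (all σ) (trans (subF-renF (liftS s) (liftR ρ) φ) (subF-cong (liftS-liftR s ρ) φ))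
  subF-renF s ρ (ex σ φ)   =
    cong (ex σ) (trans (subF-renF (liftS s) (liftR ρ) φ) (subF-cong (liftS-liftR s ρ) φ))

  mutual
    renT-subT : ∀ {Γ Δ Θ σ} (ρ : Ren Δ Θ) (s : Sub Γ Δ) (t : Term Γ σ) →
                renT ρ (subT s t) ≡ subT (λ x → renT ρ (s x)) t
    renT-subT ρ s (var x)    = refl
    renT-subT ρ s (app f ts) = cong (app f) (renTs-subTs ρ s ts)

    renTs-subTs : ∀ {Γ Δ Θ as} (ρ : Ren Δ Θ) (s : Sub Γ Δ) (ts : Terms Γ as) →
                  renTs ρ (subTs s ts) ≡ subTs (λ x → renT ρ (s x)) ts
    renTs-subTs ρ s nil       = refl
    renTs-subTs ρ s (t ∷ₜ ts) = cong₂ _∷ₜ_ (renT-subT ρ s t) (renTs-subTs ρ s ts)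

  liftR-liftS : ∀ {Γ Δ Θ τ} (ρ : Ren Δ Θ) (s : Sub Γ Δ) →
                (λ {σ} (x : (τ ∷ Γ) ∋ σ) → renT (liftR ρ) (liftS s x)) ≗ₛ liftS (λ x → renT ρ (s x))
  liftR-liftS ρ s here      = refl
  liftR-liftS ρ s (there x) = trans (renT-renT (liftR ρ) there (s x)) (sym (renT-renT there ρ (s x)))

  renF-subF : ∀ {Γ Δ Θ} (ρ : Ren Δ Θ) (s : Sub Γ Δ) (φ : Formula Γ) →
              renF ρ (subF s φ) ≡ subF (λ x → renT ρ (s x)) φ
  renF-subF ρ s ⊥'         = refl
  renF-subF ρ s (t ≐ u)    = cong₂ _≐_ (renT-subT ρ s t) (renT-subT ρ s u)
  renF-subF ρ s (rel r ts) = cong (rel r) (renTs-subTs ρ s ts)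
  renF-subF ρ s (φ ⇒ ψ)    = cong₂ _⇒_ (renF-subF ρ s φ) (renF-subF ρ s ψ)
  renF-subF ρ s (φ ∧' ψ)   = cong₂ _∧'_ (renF-subF ρ s φ) (renF-subF ρ s ψ)
  renF-subF ρ s (φ ∨' ψ)   = cong₂ _∨'_ (renF-subF ρ s φ) (renF-subF ρ s ψ)
  renF-subF ρ s (all σ φ)  =
    cong (all σ) (trans (renF-subF (liftR ρ) (liftS s) φ) (subF-cong (liftR-liftS ρ s) φ))
  renF-subF ρ s (ex σ φ)   =
    cong (ex σ) (trans (renF-subF (liftR ρ) (liftS s) φ) (subF-cong (liftR-liftS ρ s) φ))

  mutual
    subT-subT : ∀ {Γ Δ Θ σ} (s : Sub Δ Θ) (s' : Sub Γ Δ) (t : Term Γ σ) →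
                subT s (subT s' t) ≡ subT (λ x → subT s (s' x)) t
    subT-subT s s' (var x)    = refl
    subT-subT s s' (app f ts) = cong (app f) (subTs-subTs s s' ts)

    subTs-subTs : ∀ {Γ Δ Θ as} (s : Sub Δ Θ) (s' : Sub Γ Δ) (ts : Terms Γ as) →
                  subTs s (subTs s' ts) ≡ subTs (λ x → subT s (s' x)) ts
    subTs-subTs s s' nil       = refl
    subTs-subTs s s' (t ∷ₜ ts) = cong₂ _∷ₜ_ (subT-subT s s' t) (subTs-subTs s s' ts)

  liftS-liftS : ∀ {Γ Δ Θ τ} (s : Sub Δ Θ) (s' : Sub Γ Δ) →
                (λ {σ} (x : (τ ∷ Γ) ∋ σ) → subT (liftS s) (liftS s' x)) ≗ₛ liftS (λ x → subT s (s' x))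
  liftS-liftS s s' here      = refl
  liftS-liftS s s' (there x) =
    trans (subT-renT (liftS s) there (s' x)) (sym (renT-subT there s (s' x)))

  subF-subF : ∀ {Γ Δ Θ} (s : Sub Δ Θ) (s' : Sub Γ Δ) (φ : Formula Γ) →
              subF s (subF s' φ) ≡ subF (λ x → subT s (s' x)) φ
  subF-subF s s' ⊥'         = refl
  subF-subF s s' (t ≐ u)    = cong₂ _≐_ (subT-subT s s' t) (subT-subT s s' u)
  subF-subF s s' (rel r ts) = cong (rel r) (subTs-subTs s s' ts)
  subF-subF s s' (φ ⇒ ψ)    = cong₂ _⇒_ (subF-subF s s' φ) (subF-subF s s' ψ)
  subF-subF s s' (φ ∧' ψ)   = cong₂ _∧'_ (subF-subF s s' φ) (subF-subF s s' ψ)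
  subF-subF s s' (φ ∨' ψ)   = cong₂ _∨'_ (subF-subF s s' φ) (subF-subF s s' ψ)
  subF-subF s s' (all σ φ)  =
    cong (all σ) (trans (subF-subF (liftS s) (liftS s') φ) (subF-cong (liftS-liftS s s') φ))
  subF-subF s s' (ex σ φ)   =
    cong (ex σ) (trans (subF-subF (liftS s) (liftS s') φ) (subF-cong (liftS-liftS s s') φ))

  mutual
    subT-id : ∀ {Γ σ} (t : Term Γ σ) → subT var t ≡ t
    subT-id (var x)    = refl
    subT-id (app f ts) = cong (app f) (subTs-id ts)

    subTs-id : ∀ {Γ as} (ts : Terms Γ as) → subTs var ts ≡ ts
    subTs-id nil       = refl
    subTs-id (t ∷ₜ ts) = cong₂ _∷ₜ_ (subT-id t) (subTs-id ts)

  liftS-id : ∀ {Γ τ} → liftS {Γ = Γ} {τ = τ} var ≗ₛ var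
  liftS-id here      = refl
  liftS-id (there x) = refl

  subF-id : ∀ {Γ} (φ : Formula Γ) → subF var φ ≡ φ
  subF-id ⊥'         = refl
  subF-id (t ≐ u)    = cong₂ _≐_ (subT-id t) (subT-id u)
  subF-id (rel r ts) = cong (rel r) (subTs-id ts)
  subF-id (φ ⇒ ψ)    = cong₂ _⇒_ (subF-id φ) (subF-id ψ)
  subF-id (φ ∧' ψ)   = cong₂ _∧'_ (subF-id φ) (subF-id ψ)
  subF-id (φ ∨' ψ)   = cong₂ _∨'_ (subF-id φ) (subF-id ψ)
  subF-id (all σ φ)  = cong (all σ) (trans (subF-cong liftS-id φ) (subF-id φ))
  subF-id (ex σ φ)   = cong (ex σ) (trans (subF-cong liftS-id φ) (subF-id φ))

  sub0-wk : ∀ {Γ σ τ} (u : Term Γ τ) (t : Term Γ σ) → subT (sub0 u) (renT there t) ≡ t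
  sub0-wk u t = trans (subT-renT (sub0 u) there t) (subT-id t)

  infixl 5 _▹_

  _▹_ : ∀ {Θ Γ σ} → Sub Θ Γ → Term Γ σ → Sub (σ ∷ Θ) Γ
  (s ▹ v) here      = v
  (s ▹ v) (there x) = s x

  sub0-liftS : ∀ {Θ Γ σ} (s : Sub Θ Γ) (v : Term Γ σ) (φ : Formula (σ ∷ Θ)) →
               subF (sub0 v) (subF (liftS s) φ) ≡ subF (s ▹ v) φ
  sub0-liftS s v φ = trans (subF-subF (sub0 v) (liftS s) φ) (subF-cong pointwise φ)
    where
    pointwise : (λ {σ'} (x : _ ∋ σ') → subT (sub0 v) (liftS s x)) ≗ₛ (s ▹ v)
    pointwise here      = refl
    pointwise (there x) = sub0-wk v (s x)

  sub0≗var▹ : ∀ {Γ σ} (v : Term Γ σ) → sub0 v ≗ₛ var ▹ v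
  sub0≗var▹ v here      = refl
  sub0≗var▹ v (there x) = refl

  ∈h-wkHyps : ∀ {Γ τ} {φ : Formula Γ} {Δ} → φ ∈h Δ → wkF {τ = τ} φ ∈h wkHyps Δ
  ∈h-wkHyps hd     = hd
  ∈h-wkHyps (tl h) = tl (∈h-wkHyps h)

  ∈h-wkHyps⁻ : ∀ {Γ τ} {ψ : Formula (τ ∷ Γ)} {Δ : List (Formula Γ)} →
               ψ ∈h wkHyps Δ → Σ[ φ ∈ Formula Γ ] (φ ∈h Δ × ψ ≡ wkF φ)
  ∈h-wkHyps⁻ {Δ = φ ∷ Δ} hd     = φ , hd , refl
  ∈h-wkHyps⁻ {Δ = φ ∷ Δ} (tl h) with ∈h-wkHyps⁻ h
  ... | φ' , h' , e = φ' , tl h' , e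

  renF-closeF : ∀ {Γ Γ'} (ρ : Ren Γ Γ') (φ : Sentence) → renF ρ (closeF φ) ≡ closeF φ
  renF-closeF ρ φ = trans (renF-renF ρ (λ ()) φ) (renF-cong (λ ()) φ)

  renF-sub0 : ∀ {Γ Γ' σ} (ρ : Ren Γ Γ') (t : Term Γ σ) (φ : Formula (σ ∷ Γ)) →
              renF ρ (φ [ t ]) ≡ renF (liftR ρ) φ [ renT ρ t ]
  renF-sub0 ρ t φ =
    trans (renF-subF ρ (sub0 t) φ) (trans (subF-cong pointwise φ) (sym (subF-renF (sub0 (renT ρ t)) (liftR ρ) φ)))
    where
    pointwise : (λ {σ'} (x : _ ∋ σ') → renT ρ (sub0 t x)) ≗ₛ (λ x → sub0 (renT ρ t) (liftR ρ x))
    pointwise here      = refl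
    pointwise (there x) = refl

  renF-liftR-wkF : ∀ {Γ Γ' σ} (ρ : Ren Γ Γ') (φ : Formula Γ) → renF (liftR {τ = σ} ρ) (wkF φ) ≡ wkF (renF ρ φ)
  renF-liftR-wkF ρ φ = trans (renF-renF (liftR ρ) there φ) (sym (renF-renF there ρ φ))

  infix 4 _⊆ʰ_ _⊆ʰ[_]_

  _⊆ʰ_ : ∀ {Γ} → List (Formula Γ) → List (Formula Γ) → Set
  Δ ⊆ʰ Δ' = ∀ {ψ} → ψ ∈h Δ → ψ ∈h Δ'

  ⊆ʰ-cons : ∀ {Γ} {Δ Δ' : List (Formula Γ)} {χ} → Δ ⊆ʰ Δ' → (χ ∷ Δ) ⊆ʰ (χ ∷ Δ')
  ⊆ʰ-cons f hd     = hd
  ⊆ʰ-cons f (tl h) = tl (f h)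

  ⊆ʰ-wkHyps : ∀ {Γ τ} {Δ Δ' : List (Formula Γ)} → Δ ⊆ʰ Δ' → wkHyps {τ = τ} Δ ⊆ʰ wkHyps Δ'
  ⊆ʰ-wkHyps f h with ∈h-wkHyps⁻ h
  ... | φ , h' , refl = ∈h-wkHyps (f h')

  _⊆ʰ[_]_ : ∀ {Γ Γ'} → List (Formula Γ) → Ren Γ Γ' → List (Formula Γ') → Set
  Δ ⊆ʰ[ ρ ] Δ' = ∀ {ψ} → ψ ∈h Δ → renF ρ ψ ∈h Δ'

  ⊆ʰ[]-cons : ∀ {Γ Γ'} {ρ : Ren Γ Γ'} {Δ Δ' χ} → Δ ⊆ʰ[ ρ ] Δ' → (χ ∷ Δ) ⊆ʰ[ ρ ] (renF ρ χ ∷ Δ')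
  ⊆ʰ[]-cons f hd     = hd
  ⊆ʰ[]-cons f (tl h) = tl (f h)

  ⊆ʰ[]-wkHyps : ∀ {Γ Γ' τ} {ρ : Ren Γ Γ'} {Δ Δ'} → Δ ⊆ʰ[ ρ ] Δ' → wkHyps {τ = τ} Δ ⊆ʰ[ liftR ρ ] wkHyps Δ'
  ⊆ʰ[]-wkHyps {ρ = ρ} {Δ' = Δ'} f h with ∈h-wkHyps⁻ h
  ... | φ , h' , refl = subst (_∈h wkHyps Δ') (sym (renF-liftR-wkF ρ φ)) (∈h-wkHyps (f h'))

  module _ {T : Theory} where

    weakenHyps : ∀ {Γ} {Δ Δ' : List (Formula Γ)} {φ} → Δ ⊆ʰ Δ' → Deriv T Γ Δ φ → Deriv T Γ Δ' φ
    weakenHyps f (hyp h)          = hyp (f h)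
    weakenHyps f (axm a)          = axm a
    weakenHyps f (⊥E d)           = ⊥E (weakenHyps f d)
    weakenHyps f (raa d)          = raa (weakenHyps (⊆ʰ-cons f) d)
    weakenHyps f (⇒I d)           = ⇒I (weakenHyps (⊆ʰ-cons f) d)
    weakenHyps f (⇒E d e)         = ⇒E (weakenHyps f d) (weakenHyps f e)
    weakenHyps f (∧I d e)         = ∧I (weakenHyps f d) (weakenHyps f e)
    weakenHyps f (∧E₁ d)          = ∧E₁ (weakenHyps f d)
    weakenHyps f (∧E₂ d)          = ∧E₂ (weakenHyps f d)
    weakenHyps f (∨I₁ d)          = ∨I₁ (weakenHyps f d)
    weakenHyps f (∨I₂ d)          = ∨I₂ (weakenHyps f d)
    weakenHyps f (∨E d e₁ e₂)     = ∨E (weakenHyps f d) (weakenHyps (⊆ʰ-cons f) e₁) (weakenHyps (⊆ʰ-cons f) e₂)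
    weakenHyps f (∀I d)           = ∀I (weakenHyps (⊆ʰ-wkHyps f) d)
    weakenHyps f (∀E d t)         = ∀E (weakenHyps f d) t
    weakenHyps f (∃I t d)         = ∃I t (weakenHyps f d)
    weakenHyps f (∃E d e)         = ∃E (weakenHyps f d) (weakenHyps (⊆ʰ-cons (⊆ʰ-wkHyps f)) e)
    weakenHyps f (≐refl t)        = ≐refl t
    weakenHyps f (≐subst φ e d)   = ≐subst φ (weakenHyps f e) (weakenHyps f d)

    weaken₁ : ∀ {Γ} {Δ : List (Formula Γ)} {φ χ} → Deriv T Γ Δ φ → Deriv T Γ (χ ∷ Δ) φ
    weaken₁ = weakenHyps tl

    renameDeriv : ∀ {Γ Γ'} {Δ : List (Formula Γ)} {Δ' : List (Formula Γ')} {φ} (ρ : Ren Γ Γ') →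
                  Δ ⊆ʰ[ ρ ] Δ' → Deriv T Γ Δ φ → Deriv T Γ' Δ' (renF ρ φ)
    renameDeriv ρ f (hyp h)         = hyp (f h)
    renameDeriv ρ f (axm {φ} a)     = subst (Deriv T _ _) (sym (renF-closeF ρ φ)) (axm a)
    renameDeriv ρ f (⊥E d)          = ⊥E (renameDeriv ρ f d)
    renameDeriv ρ f (raa d)         = raa (renameDeriv ρ (⊆ʰ[]-cons f) d)
    renameDeriv ρ f (⇒I d)          = ⇒I (renameDeriv ρ (⊆ʰ[]-cons f) d)
    renameDeriv ρ f (⇒E d e)        = ⇒E (renameDeriv ρ f d) (renameDeriv ρ f e)
    renameDeriv ρ f (∧I d e)        = ∧I (renameDeriv ρ f d) (renameDeriv ρ f e)
    renameDeriv ρ f (∧E₁ d)         = ∧E₁ (renameDeriv ρ f d)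
    renameDeriv ρ f (∧E₂ d)         = ∧E₂ (renameDeriv ρ f d)
    renameDeriv ρ f (∨I₁ d)         = ∨I₁ (renameDeriv ρ f d)
    renameDeriv ρ f (∨I₂ d)         = ∨I₂ (renameDeriv ρ f d)
    renameDeriv ρ f (∨E d e₁ e₂)    =
      ∨E (renameDeriv ρ f d) (renameDeriv ρ (⊆ʰ[]-cons f) e₁) (renameDeriv ρ (⊆ʰ[]-cons f) e₂)
    renameDeriv ρ f (∀I d)          = ∀I (renameDeriv (liftR ρ) (⊆ʰ[]-wkHyps f) d)
    renameDeriv ρ f (∀E {φ = φ} d t) =
      subst (Deriv T _ _) (sym (renF-sub0 ρ t φ)) (∀E (renameDeriv ρ f d) (renT ρ t))
    renameDeriv ρ f (∃I {φ = φ} t d) =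
      ∃I (renT ρ t) (subst (Deriv T _ _) (renF-sub0 ρ t φ) (renameDeriv ρ f d))
    renameDeriv ρ f (∃E {ψ = ψ} d e) =
      ∃E (renameDeriv ρ f d)
         (subst (Deriv T _ _) (renF-liftR-wkF ρ ψ) (renameDeriv (liftR ρ) (⊆ʰ[]-cons (⊆ʰ[]-wkHyps f)) e))
    renameDeriv ρ f (≐refl t)       = ≐refl (renT ρ t)
    renameDeriv ρ f (≐subst {t = t} {u} φ e d) =
      subst (Deriv T _ _) (sym (renF-sub0 ρ u φ))
        (≐subst (renF (liftR ρ) φ) (renameDeriv ρ f e)
           (subst (Deriv T _ _) (renF-sub0 ρ t φ) (renameDeriv ρ f d)))

    weakenCtx : ∀ {Γ τ} {Δ : List (Formula Γ)} {φ χ} → Deriv T Γ Δ φ → Deriv T (τ ∷ Γ) (χ ∷ wkHyps Δ) (wkF φ)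
    weakenCtx = renameDeriv there (λ h → tl (∈h-wkHyps h))

    ∀E▹ : ∀ {Θ Γ Δ σ} {φ : Formula (σ ∷ Θ)} (s : Sub Θ Γ) →
          Deriv T Γ Δ (subF s (all σ φ)) → (t : Term Γ σ) → Deriv T Γ Δ (subF (s ▹ t) φ)
    ∀E▹ {φ = φ} s d t = subst (Deriv T _ _) (sub0-liftS s t φ) (∀E d t)

    ∃I▹ : ∀ {Θ Γ Δ σ} {φ : Formula (σ ∷ Θ)} (s : Sub Θ Γ) (t : Term Γ σ) →
          Deriv T Γ Δ (subF (s ▹ t) φ) → Deriv T Γ Δ (subF s (ex σ φ))
    ∃I▹ {φ = φ} s t d = ∃I t (subst (Deriv T _ _) (sym (sub0-liftS s t φ)) d)

    ∀E-var▹ : ∀ {Γ Δ σ} {φ : Formula (σ ∷ Γ)} → Deriv T Γ Δ (all σ φ) → (t : Term Γ σ) → Deriv T Γ Δ (subF (var ▹ t) φ)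
    ∀E-var▹ {φ = φ} d t = subst (Deriv T _ _) (subF-cong (sub0≗var▹ t) φ) (∀E d t)

    ∃I-var▹ : ∀ {Γ Δ σ} {φ : Formula (σ ∷ Γ)} (t : Term Γ σ) → Deriv T Γ Δ (subF (var ▹ t) φ) → Deriv T Γ Δ (ex σ φ)
    ∃I-var▹ {φ = φ} t d = ∃I t (subst (Deriv T _ _) (sym (subF-cong (sub0≗var▹ t) φ)) d)

module PAminusReasoning where

  open import Data.List using (List; _∷_)
  open import Data.Unit using (⊤; tt)
  open import Data.Product using (_,_)
  open import Level using (0ℓ)
  open import Relation.Binary.Structures using (IsEquivalence)
  open import Algebra.Bundles using (CommutativeSemiring)
  open import Algebra.Structures.Biased using (isCommutativeSemiringˡ)
  import Algebra.Solver.Ring.NaturalCoefficients.Default as NaturalSolver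

  open SyntaxProperties PASig public
  open PA public
    using (var; here; there; _≐_; ⊥'; _⇒_; _∧'_; _∨'_; Deriv; hyp; axm; ⊥E; raa; ⇒I; ⇒E; ∧I; ∧E₁; ∧E₂; ∨I₁; ∨I₂; ∨E;
           ∀I; ∀E; ∃I; ∃E; ≐refl; ≐subst; hd; tl; wkF; wkHyps; subF; subT; renT; renF; sub0; _∈h_)

  infix 0 _⊢ₚ_

  _⊢ₚ_ : ∀ {Γ} → List (PFormula Γ) → PFormula Γ → Set
  _⊢ₚ_ {Γ} Δ φ = Deriv PAminus Γ Δ φ

  module _ {Γ : List ⊤} {Δ : List (PFormula Γ)} where

    ∀E₁ : ∀ {φ} → Δ ⊢ₚ ∀ₚ φ → (t : PTerm Γ) → Δ ⊢ₚ subF (var ▹ t) φ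
    ∀E₁ = ∀E-var▹

    ∀E₂ : ∀ {φ} → Δ ⊢ₚ ∀ₚ (∀ₚ φ) → (t u : PTerm Γ) → Δ ⊢ₚ subF (var ▹ t ▹ u) φ
    ∀E₂ d t u = ∀E▹ _ (∀E₁ d t) u

    ∀E₃ : ∀ {φ} → Δ ⊢ₚ ∀ₚ (∀ₚ (∀ₚ φ)) → (t u v : PTerm Γ) → Δ ⊢ₚ subF (var ▹ t ▹ u ▹ v) φ
    ∀E₃ d t u v = ∀E▹ _ (∀E₂ d t u) v

    ∀E₄ : ∀ {φ} → Δ ⊢ₚ ∀ₚ (∀ₚ (∀ₚ (∀ₚ φ))) → (t u v w : PTerm Γ) → Δ ⊢ₚ subF (var ▹ t ▹ u ▹ v ▹ w) φ
    ∀E₄ d t u v w = ∀E▹ _ (∀E₃ d t u v) w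

    ∃I₄ : ∀ {φ} (t u v w : PTerm Γ) → Δ ⊢ₚ subF (var ▹ t ▹ u ▹ v ▹ w) φ → Δ ⊢ₚ ∃ₚ (∃ₚ (∃ₚ (∃ₚ φ)))
    ∃I₄ t u v w d = ∃I-var▹ t (∃I▹ _ u (∃I▹ _ v (∃I▹ _ w d)))

    private
      p4 : ∀ {Γ'} → PTerm (tt ∷ tt ∷ tt ∷ tt ∷ tt ∷ Γ')
      p4 = var (there (there (there (there here))))

      symᶜ : Δ ⊢ₚ ∀ₚ (∀ₚ (p1 ≐ p0 ⇒ p0 ≐ p1))
      symᶜ = ∀I (∀I (⇒I (≐subst (p0 ≐ p2) (hyp hd) (≐refl p1))))

      transᶜ : Δ ⊢ₚ ∀ₚ (∀ₚ (∀ₚ (p2 ≐ p1 ⇒ p1 ≐ p0 ⇒ p2 ≐ p0)))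
      transᶜ = ∀I (∀I (∀I (⇒I (⇒I (≐subst (p3 ≐ p0) (hyp hd) (hyp (tl hd)))))))

      ⊕-congᶜ : Δ ⊢ₚ ∀ₚ (∀ₚ (∀ₚ (∀ₚ (p3 ≐ p2 ⇒ p1 ≐ p0 ⇒ p3 ⊕ p1 ≐ p2 ⊕ p0))))
      ⊕-congᶜ = ∀I (∀I (∀I (∀I (⇒I (⇒I
        (≐subst (p4 ⊕ p2 ≐ p3 ⊕ p0) (hyp hd) (≐subst (p4 ⊕ p2 ≐ p0 ⊕ p2) (hyp (tl hd)) (≐refl (p3 ⊕ p1)))))))))

      ⊗-congᶜ : Δ ⊢ₚ ∀ₚ (∀ₚ (∀ₚ (∀ₚ (p3 ≐ p2 ⇒ p1 ≐ p0 ⇒ p3 ⊗ p1 ≐ p2 ⊗ p0))))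
      ⊗-congᶜ = ∀I (∀I (∀I (∀I (⇒I (⇒I
        (≐subst (p4 ⊗ p2 ≐ p3 ⊗ p0) (hyp hd) (≐subst (p4 ⊗ p2 ≐ p0 ⊗ p2) (hyp (tl hd)) (≐refl (p3 ⊗ p1)))))))))

      ≼-congᶜ : Δ ⊢ₚ ∀ₚ (∀ₚ (∀ₚ (∀ₚ (p3 ≐ p2 ⇒ p1 ≐ p0 ⇒ p3 ≼ p1 ⇒ p2 ≼ p0))))
      ≼-congᶜ = ∀I (∀I (∀I (∀I (⇒I (⇒I (⇒I
        (≐subst (p3 ≼ p0) (hyp (tl hd)) (≐subst (p0 ≼ p2) (hyp (tl (tl hd))) (hyp hd)))))))))

    ≐sym : ∀ {t u} → Δ ⊢ₚ t ≐ u → Δ ⊢ₚ u ≐ t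
    ≐sym {t} {u} = ⇒E (∀E₂ symᶜ t u)

    ≐trans : ∀ {t u v} → Δ ⊢ₚ t ≐ u → Δ ⊢ₚ u ≐ v → Δ ⊢ₚ t ≐ v
    ≐trans {t} {u} {v} d = ⇒E (⇒E (∀E₃ transᶜ t u v) d)

    ⊕-cong : ∀ {t t' u u'} → Δ ⊢ₚ t ≐ t' → Δ ⊢ₚ u ≐ u' → Δ ⊢ₚ t ⊕ u ≐ t' ⊕ u'
    ⊕-cong {t} {t'} {u} {u'} d = ⇒E (⇒E (∀E₄ ⊕-congᶜ t t' u u') d)

    ⊗-cong : ∀ {t t' u u'} → Δ ⊢ₚ t ≐ t' → Δ ⊢ₚ u ≐ u' → Δ ⊢ₚ t ⊗ u ≐ t' ⊗ u'
    ⊗-cong {t} {t'} {u} {u'} d = ⇒E (⇒E (∀E₄ ⊗-congᶜ t t' u u') d)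

    ≼-resp-≐ : ∀ {t t' u u'} → Δ ⊢ₚ t ≐ t' → Δ ⊢ₚ u ≐ u' → Δ ⊢ₚ t ≼ u → Δ ⊢ₚ t' ≼ u'
    ≼-resp-≐ {t} {t'} {u} {u'} d e = ⇒E (⇒E (⇒E (∀E₄ ≼-congᶜ t t' u u') d) e)

  termSemiring : (Γ : List ⊤) (Δ : List (PFormula Γ)) → CommutativeSemiring 0ℓ 0ℓ
  termSemiring Γ Δ = record
    { Carrier = PTerm Γ
    ; _≈_ = λ t u → Δ ⊢ₚ t ≐ u
    ; _+_ = _⊕_
    ; _*_ = _⊗_
    ; 0# = 𝟘
    ; 1# = 𝟙
    ; isCommutativeSemiring = isCommutativeSemiringˡ record
      { +-isCommutativeMonoid = record
        { isMonoid = record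
          { isSemigroup = record
            { isMagma = record { isEquivalence = ≐-isEquivalence ; ∙-cong = ⊕-cong }
            ; assoc = ∀E₃ (axm add-assoc) }
          ; identity = (λ t → ≐trans (∀E₂ (axm add-comm) 𝟘 t) (∀E₁ (axm add-zero) t)) , ∀E₁ (axm add-zero) }
        ; comm = ∀E₂ (axm add-comm) }
      ; *-isCommutativeMonoid = record
        { isMonoid = record
          { isSemigroup = record
            { isMagma = record { isEquivalence = ≐-isEquivalence ; ∙-cong = ⊗-cong }
            ; assoc = ∀E₃ (axm mul-assoc) }
          ; identity = (λ t → ≐trans (∀E₂ (axm mul-comm) 𝟙 t) (∀E₁ (axm mul-one) t)) , ∀E₁ (axm mul-one) }
        ; comm = ∀E₂ (axm mul-comm) }
      ; distribʳ = λ x y z → ≐trans (∀E₂ (axm mul-comm) (y ⊕ z) x)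
                               (≐trans (∀E₃ (axm distrib) x y z) (⊕-cong (∀E₂ (axm mul-comm) x y) (∀E₂ (axm mul-comm) x z)))
      ; zeroˡ = λ t → ≐trans (∀E₂ (axm mul-comm) 𝟘 t) (∀E₁ (axm mul-zero) t)
      }
    }
    where
    ≐-isEquivalence : IsEquivalence (λ t u → Δ ⊢ₚ t ≐ u)
    ≐-isEquivalence = record { refl = ≐refl _ ; sym = ≐sym ; trans = ≐trans }

  module Solver {Γ : List ⊤} (Δ : List (PFormula Γ)) = NaturalSolver (termSemiring Γ Δ)

  module _ {Γ : List ⊤} {Δ : List (PFormula Γ)} where
    open CommutativeSemiring (termSemiring Γ Δ) public
      using () renaming
      ( +-comm to ⊕-comm; *-comm to ⊗-comm; +-identityˡ to ⊕-identityˡ; +-identityʳ to ⊕-identityʳ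
      ; *-identityˡ to ⊗-identityˡ; *-identityʳ to ⊗-identityʳ; zeroˡ to ⊗-zeroˡ; zeroʳ to ⊗-zeroʳ)

module PAminusOrder where

  open import Data.List using (List; _∷_)
  open import Data.Unit using (⊤)
  open PAminusReasoning

  private variable
    Γ : List ⊤
    Δ : List (PFormula Γ)

  ≼-refl : ∀ t → Δ ⊢ₚ t ≼ t
  ≼-refl = ∀E₁ (axm le-refl)

  ≼-antisym : ∀ {t u} → Δ ⊢ₚ t ≼ u → Δ ⊢ₚ u ≼ t → Δ ⊢ₚ t ≐ u
  ≼-antisym {t = t} {u} d e = ⇒E (∀E₂ (axm le-antisym) t u) (∧I d e)

  ≼-trans : ∀ {t u v} → Δ ⊢ₚ t ≼ u → Δ ⊢ₚ u ≼ v → Δ ⊢ₚ t ≼ v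
  ≼-trans {t = t} {u} {v} d e = ⇒E (∀E₃ (axm le-trans) t u v) (∧I d e)

  ≼-total : ∀ t u → Δ ⊢ₚ t ≼ u ∨' u ≼ t
  ≼-total = ∀E₂ (axm le-total)

  1+n≰n : ∀ {t} → Δ ⊢ₚ t ⊕ 𝟙 ≼ t → Δ ⊢ₚ ⊥'
  1+n≰n {t = t} = ⇒E (∀E₁ (axm succ-nle) t)

  ≼-discrete : ∀ {t u} → Δ ⊢ₚ t ≼ u → Δ ⊢ₚ t ≐ u ∨' t ⊕ 𝟙 ≼ u
  ≼-discrete {t = t} {u} = ⇒E (∀E₂ (axm discrete) u t)

  ⊕-monoˡ-≼ : ∀ {t u} v → Δ ⊢ₚ t ≼ u → Δ ⊢ₚ t ⊕ v ≼ u ⊕ v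
  ⊕-monoˡ-≼ {t = t} {u} v = ⇒E (∀E₃ (axm mono-add) u t v)

  ⊗-monoˡ-≼ : ∀ {t u} v → Δ ⊢ₚ t ≼ u → Δ ⊢ₚ t ⊗ v ≼ u ⊗ v
  ⊗-monoˡ-≼ {t = t} {u} v = ⇒E (∀E₃ (axm mono-mul) u t v)

  subtraction : ∀ {t u} → Δ ⊢ₚ t ≼ u → Δ ⊢ₚ ∃ₚ (renT there u ≐ renT there t ⊕ p0)
  subtraction {t = t} {u} = ⇒E (∀E₂ (axm subtract) u t)

  ≐⇒≼ : ∀ {t u} → Δ ⊢ₚ t ≐ u → Δ ⊢ₚ t ≼ u
  ≐⇒≼ {t = t} d = ≼-resp-≐ (≐refl t) d (≼-refl t)

  ≐≼≐ : ∀ {t t' u u'} → Δ ⊢ₚ t ≐ t' → Δ ⊢ₚ t' ≼ u' → Δ ⊢ₚ u' ≐ u → Δ ⊢ₚ t ≼ u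
  ≐≼≐ e d f = ≼-resp-≐ (≐sym e) f d

  𝟙≰𝟘 : Δ ⊢ₚ 𝟙 ≼ 𝟘 → Δ ⊢ₚ ⊥'
  𝟙≰𝟘 d = 1+n≰n (≼-resp-≐ (≐sym (⊕-identityˡ 𝟙)) (≐refl _) d)

  𝟘≼ : ∀ t → Δ ⊢ₚ 𝟘 ≼ t
  𝟘≼ t = ∨E (≼-total 𝟘 t) (hyp hd) (≼-resp-≐ (⊗-zeroˡ t) (⊗-identityˡ t) (⊗-monoˡ-≼ t 𝟘≼𝟙))
    where
    𝟘≼𝟙 : ∀ {Δ'} → Δ' ⊢ₚ 𝟘 ≼ 𝟙
    𝟘≼𝟙 = ∨E (≼-total 𝟘 𝟙) (hyp hd) (⊥E (𝟙≰𝟘 (hyp hd)))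

  ⊕-monoʳ-≼ : ∀ {t u} v → Δ ⊢ₚ t ≼ u → Δ ⊢ₚ v ⊕ t ≼ v ⊕ u
  ⊕-monoʳ-≼ {t = t} {u} v d = ≼-resp-≐ (⊕-comm t v) (⊕-comm u v) (⊕-monoˡ-≼ v d)

  ⊗-monoʳ-≼ : ∀ {t u} v → Δ ⊢ₚ t ≼ u → Δ ⊢ₚ v ⊗ t ≼ v ⊗ u
  ⊗-monoʳ-≼ {t = t} {u} v d = ≼-resp-≐ (⊗-comm t v) (⊗-comm u v) (⊗-monoˡ-≼ v d)

  ⊕-mono-≼ : ∀ {t t' u u'} → Δ ⊢ₚ t ≼ t' → Δ ⊢ₚ u ≼ u' → Δ ⊢ₚ t ⊕ u ≼ t' ⊕ u'
  ⊕-mono-≼ {t' = t'} {u} d e = ≼-trans (⊕-monoˡ-≼ u d) (⊕-monoʳ-≼ t' e)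

  ⊗-mono-≼ : ∀ {t t' u u'} → Δ ⊢ₚ t ≼ t' → Δ ⊢ₚ u ≼ u' → Δ ⊢ₚ t ⊗ u ≼ t' ⊗ u'
  ⊗-mono-≼ {t' = t'} {u} d e = ≼-trans (⊗-monoˡ-≼ u d) (⊗-monoʳ-≼ t' e)

  m≼m⊕n : ∀ t u → Δ ⊢ₚ t ≼ t ⊕ u
  m≼m⊕n t u = ≼-resp-≐ (⊕-identityʳ t) (≐refl _) (⊕-monoʳ-≼ t (𝟘≼ u))

  m≼n⊕m : ∀ t u → Δ ⊢ₚ t ≼ u ⊕ t
  m≼n⊕m t u = ≼-resp-≐ (≐refl _) (⊕-comm t u) (m≼m⊕n t u)

  <⇒≼ : ∀ {t u} → Δ ⊢ₚ t ⊕ 𝟙 ≼ u → Δ ⊢ₚ t ≼ u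
  <⇒≼ {t = t} = ≼-trans (m≼m⊕n t 𝟙)

  zero∨positive : ∀ t → Δ ⊢ₚ t ≐ 𝟘 ∨' 𝟙 ≼ t
  zero∨positive t =
    ∨E (≼-discrete (𝟘≼ t)) (∨I₁ (≐sym (hyp hd))) (∨I₂ (≼-resp-≐ (⊕-identityˡ 𝟙) (≐refl _) (hyp hd)))

  1+n≢𝟘 : ∀ {t} → Δ ⊢ₚ t ⊕ 𝟙 ≐ 𝟘 → Δ ⊢ₚ ⊥'
  1+n≢𝟘 {t = t} e = 𝟙≰𝟘 (≼-resp-≐ (≐refl _) e (m≼n⊕m 𝟙 t))

  ≼∨> : ∀ t u → Δ ⊢ₚ t ≼ u ∨' u ⊕ 𝟙 ≼ t
  ≼∨> t u = ∨E (≼-total t u) (∨I₁ (hyp hd))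
    (∨E (≼-discrete (hyp hd)) (∨I₁ (≐⇒≼ (≐sym (hyp hd)))) (∨I₂ (hyp hd)))

  ⊕-cancelʳ-≼ : ∀ {t u} v → Δ ⊢ₚ t ⊕ v ≼ u ⊕ v → Δ ⊢ₚ t ≼ u
  ⊕-cancelʳ-≼ {Δ = Δ} {t = t} {u} v d = ∨E (≼∨> t u) (hyp hd)
    (⊥E (1+n≰n (≼-trans (≼-resp-≐ (shift u v) (≐refl _) (⊕-monoˡ-≼ v (hyp hd))) (weaken₁ d))))
    where
    open Solver (_ ∷ Δ)
    shift : ∀ u v → _ ⊢ₚ (u ⊕ 𝟙) ⊕ v ≐ (u ⊕ v) ⊕ 𝟙
    shift = solve 2 (λ u v → (u :+ con 1) :+ v := (u :+ v) :+ con 1) (≐refl _)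

  ⊕-cancelʳ-≐ : ∀ {t u} v → Δ ⊢ₚ t ⊕ v ≐ u ⊕ v → Δ ⊢ₚ t ≐ u
  ⊕-cancelʳ-≐ v d = ≼-antisym (⊕-cancelʳ-≼ v (≐⇒≼ d)) (⊕-cancelʳ-≼ v (≐⇒≼ (≐sym d)))

  ⊕-cancelˡ-≐ : ∀ {t u} v → Δ ⊢ₚ v ⊕ t ≐ v ⊕ u → Δ ⊢ₚ t ≐ u
  ⊕-cancelˡ-≐ {t = t} {u} v d = ⊕-cancelʳ-≐ v (≐trans (⊕-comm t v) (≐trans d (⊕-comm v u)))

  ⊗-cancelʳ-≼ : ∀ {t u w} → Δ ⊢ₚ 𝟙 ≼ w → Δ ⊢ₚ t ⊗ w ≼ u ⊗ w → Δ ⊢ₚ t ≼ u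
  ⊗-cancelʳ-≼ {Δ = Δ} {t = t} {u} {w} w≥1 d = ∨E (≼∨> t u) (hyp hd)
    (⊥E (1+n≰n (≼-trans (⊕-monoʳ-≼ (u ⊗ w) (weaken₁ w≥1))
                        (≼-trans (≼-resp-≐ (expand u w) (≐refl _) (⊗-monoˡ-≼ w (hyp hd))) (weaken₁ d)))))
    where
    open Solver (_ ∷ Δ)
    expand : ∀ u w → _ ⊢ₚ (u ⊕ 𝟙) ⊗ w ≐ u ⊗ w ⊕ w
    expand = solve 2 (λ u w → (u :+ con 1) :* w := u :* w :+ w) (≐refl _)

  -- Reduces an identity that holds only modulo hypotheses to a semiring identity
  -- P + R = Q + L (for the solver) plus the hypothesis L = R.
  ≐-by-cancelling : ∀ {P Q L R : PTerm Γ} → Δ ⊢ₚ P ⊕ R ≐ Q ⊕ L → Δ ⊢ₚ L ≐ R → Δ ⊢ₚ P ≐ Q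
  ≐-by-cancelling {R = R} s h = ⊕-cancelʳ-≐ R (≐trans s (⊕-cong (≐refl _) h))

  ⊗-positive : ∀ {t u} → Δ ⊢ₚ 𝟙 ≼ t → Δ ⊢ₚ 𝟙 ≼ u → Δ ⊢ₚ 𝟙 ≼ t ⊗ u
  ⊗-positive d e = ≼-resp-≐ (⊗-identityˡ 𝟙) (≐refl _) (⊗-mono-≼ d e)

  m⊕n≐𝟘⇒m≐𝟘 : ∀ {t u} → Δ ⊢ₚ t ⊕ u ≐ 𝟘 → Δ ⊢ₚ t ≐ 𝟘
  m⊕n≐𝟘⇒m≐𝟘 {t = t} {u} d = ∨E (zero∨positive t) (hyp hd)
    (⊥E (𝟙≰𝟘 (≼-trans (hyp hd) (≼-resp-≐ (≐refl _) (weaken₁ d) (m≼m⊕n t u)))))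

  m⊕n≐𝟘⇒n≐𝟘 : ∀ {t u} → Δ ⊢ₚ t ⊕ u ≐ 𝟘 → Δ ⊢ₚ u ≐ 𝟘
  m⊕n≐𝟘⇒n≐𝟘 {t = t} {u} d = m⊕n≐𝟘⇒m≐𝟘 (≐trans (⊕-comm u t) d)

  m⊗n≐𝟘⇒m≐𝟘∨n≐𝟘 : ∀ {t u} → Δ ⊢ₚ t ⊗ u ≐ 𝟘 → Δ ⊢ₚ t ≐ 𝟘 ∨' u ≐ 𝟘
  m⊗n≐𝟘⇒m≐𝟘∨n≐𝟘 {t = t} {u} d = ∨E (zero∨positive t) (∨I₁ (hyp hd))
    (∨E (zero∨positive u) (∨I₂ (hyp hd))
      (⊥E (𝟙≰𝟘 (≼-resp-≐ (≐refl _) (weaken₁ (weaken₁ d)) (⊗-positive (hyp (tl hd)) (hyp hd))))))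

  m⊗n≐𝟘⇒n≐𝟘 : ∀ {t u} → Δ ⊢ₚ 𝟙 ≼ t → Δ ⊢ₚ t ⊗ u ≐ 𝟘 → Δ ⊢ₚ u ≐ 𝟘
  m⊗n≐𝟘⇒n≐𝟘 t≥1 d =
    ∨E (m⊗n≐𝟘⇒m≐𝟘∨n≐𝟘 d) (⊥E (𝟙≰𝟘 (≼-resp-≐ (≐refl _) (hyp hd) (weaken₁ t≥1)))) (hyp hd)

  m⊗n≐𝟘⇒m≐𝟘 : ∀ {t u} → Δ ⊢ₚ 𝟙 ≼ u → Δ ⊢ₚ t ⊗ u ≐ 𝟘 → Δ ⊢ₚ t ≐ 𝟘
  m⊗n≐𝟘⇒m≐𝟘 {t = t} {u} u≥1 d = m⊗n≐𝟘⇒n≐𝟘 u≥1 (≐trans (⊗-comm u t) d)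

  m⊗n≐1+k⇒𝟙≼m : ∀ {t u v} → Δ ⊢ₚ t ⊗ u ≐ v ⊕ 𝟙 → Δ ⊢ₚ 𝟙 ≼ t
  m⊗n≐1+k⇒𝟙≼m {t = t} {u} d = ∨E (zero∨positive t)
    (⊥E (1+n≢𝟘 (≐trans (≐sym (weaken₁ d)) (≐trans (⊗-cong (hyp hd) (≐refl u)) (⊗-zeroˡ u)))))
    (hyp hd)

  m⊗n≐1+k⇒𝟙≼n : ∀ {t u v} → Δ ⊢ₚ t ⊗ u ≐ v ⊕ 𝟙 → Δ ⊢ₚ 𝟙 ≼ u
  m⊗n≐1+k⇒𝟙≼n {t = t} {u} d = m⊗n≐1+k⇒𝟙≼m (≐trans (⊗-comm u t) d)

  m⊗n≐𝟙⇒m≐𝟙 : ∀ {t u} → Δ ⊢ₚ t ⊗ u ≐ 𝟙 → Δ ⊢ₚ t ≐ 𝟙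
  m⊗n≐𝟙⇒m≐𝟙 {t = t} d = ≼-antisym
    (≐≼≐ (≐sym (⊗-identityʳ t)) (⊗-monoʳ-≼ t (m⊗n≐1+k⇒𝟙≼n d')) d)
    (m⊗n≐1+k⇒𝟙≼m d')
    where
    d' = ≐trans d (≐sym (⊕-identityˡ 𝟙))

  m⊗n≐𝟙⇒n≐𝟙 : ∀ {t u} → Δ ⊢ₚ t ⊗ u ≐ 𝟙 → Δ ⊢ₚ u ≐ 𝟙
  m⊗n≐𝟙⇒n≐𝟙 {t = t} {u} d = m⊗n≐𝟙⇒m≐𝟙 (≐trans (⊗-comm u t) d)

  m≐𝟘⇒m⊗n≐𝟘 : ∀ {t} u → Δ ⊢ₚ t ≐ 𝟘 → Δ ⊢ₚ t ⊗ u ≐ 𝟘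
  m≐𝟘⇒m⊗n≐𝟘 u e = ≐trans (⊗-cong e (≐refl u)) (⊗-zeroˡ u)

  n≐𝟘⇒m⊗n≐𝟘 : ∀ t {u} → Δ ⊢ₚ u ≐ 𝟘 → Δ ⊢ₚ t ⊗ u ≐ 𝟘
  n≐𝟘⇒m⊗n≐𝟘 t e = ≐trans (⊗-cong (≐refl t) e) (⊗-zeroʳ t)

module Matrices where

  open import Data.List using (List)
  open import Data.Unit using (⊤)
  open PAminusReasoning
  open PAminusOrder

  private variable
    Γ : List ⊤
    Δ : List (PFormula Γ)

  I₂ : Mat Γ
  I₂ = mat 𝟙 𝟘 𝟘 𝟙

  -- Dom A is definitionally Det A ∧' Shape A.
  Det Shape : Mat Γ → PFormula Γ
  Det (mat a b c d) = a ⊗ d ≐ b ⊗ c ⊕ 𝟙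
  Shape (mat a b c d) = (b ≐ 𝟘 ∧' c ≐ 𝟘) ∨' (a ≼ c ∧' b ≼ d)

  EqM-refl : ∀ (A : Mat Γ) → Δ ⊢ₚ EqM A A
  EqM-refl A = ∧I (≐refl _) (∧I (≐refl _) (∧I (≐refl _) (≐refl _)))

  EqM-sym : ∀ {A B : Mat Γ} → Δ ⊢ₚ EqM A B → Δ ⊢ₚ EqM B A
  EqM-sym h = ∧I (≐sym (∧E₁ h)) (∧I (≐sym (∧E₁ (∧E₂ h))) (∧I (≐sym (∧E₁ (∧E₂ (∧E₂ h)))) (≐sym (∧E₂ (∧E₂ (∧E₂ h))))))

  EqM-trans : ∀ {A B C : Mat Γ} → Δ ⊢ₚ EqM A B → Δ ⊢ₚ EqM B C → Δ ⊢ₚ EqM A C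
  EqM-trans h k = ∧I (≐trans (∧E₁ h) (∧E₁ k)) (∧I (≐trans (∧E₁ (∧E₂ h)) (∧E₁ (∧E₂ k)))
    (∧I (≐trans (∧E₁ (∧E₂ (∧E₂ h))) (∧E₁ (∧E₂ (∧E₂ k)))) (≐trans (∧E₂ (∧E₂ (∧E₂ h))) (∧E₂ (∧E₂ (∧E₂ k))))))

  Shape-resp-EqM : ∀ {A B : Mat Γ} → Δ ⊢ₚ EqM A B → Δ ⊢ₚ Shape A → Δ ⊢ₚ Shape B
  Shape-resp-EqM H s = ∨E s
    (∨I₁ (∧I (≐trans (≐sym (weaken₁ (∧E₁ (∧E₂ H)))) (∧E₁ (hyp hd)))
             (≐trans (≐sym (weaken₁ (∧E₁ (∧E₂ (∧E₂ H))))) (∧E₂ (hyp hd)))))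
    (∨I₂ (∧I (≼-resp-≐ (weaken₁ (∧E₁ H)) (weaken₁ (∧E₁ (∧E₂ (∧E₂ H)))) (∧E₁ (hyp hd)))
             (≼-resp-≐ (weaken₁ (∧E₁ (∧E₂ H))) (weaken₁ (∧E₂ (∧E₂ (∧E₂ H)))) (∧E₂ (hyp hd)))))

  Dom-I₂ : Δ ⊢ₚ Dom {Γ} I₂
  Dom-I₂ = ∧I (≐trans (⊗-identityˡ 𝟙) (≐sym (≐trans (⊕-cong (⊗-zeroˡ 𝟘) (≐refl 𝟙)) (⊕-identityˡ 𝟙))))
              (∨I₁ (∧I (≐refl _) (≐refl _)))

  Dom-atom : ∀ (t : PTerm Γ) → Δ ⊢ₚ Dom (mat 𝟙 t 𝟙 (t ⊕ 𝟙))
  Dom-atom {Δ = Δ} t = ∧I (solve 1 (λ t → con 1 :* (t :+ con 1) := t :* con 1 :+ con 1) (≐refl _) t)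
                          (∨I₂ (∧I (≼-refl 𝟙) (m≼m⊕n t 𝟙)))
    where open Solver Δ

  det-·ₘ : ∀ {A B : Mat Γ} → Δ ⊢ₚ Det A → Δ ⊢ₚ Det B → Δ ⊢ₚ Det (A ·ₘ B)
  det-·ₘ {Δ = Δ} {mat a b c d} {mat e f g h} detA detB =
    ≐-by-cancelling
      (solve 8 (λ a b c d e f g h →
           (a :* e :+ b :* g) :* (c :* f :+ d :* h)
             :+ ((b :* c :+ con 1) :* (e :* h) :+ (a :* d) :* (f :* g) :+ (f :* g :+ con 1))
        := (a :* f :+ b :* h) :* (c :* e :+ d :* g) :+ con 1
             :+ ((a :* d) :* (e :* h) :+ (b :* c :+ con 1) :* (f :* g) :+ e :* h))
        (≐refl _) a b c d e f g h)
      (⊕-cong (⊕-cong (⊗-cong detA (≐refl (e ⊗ h))) (≐sym (⊗-cong detA (≐refl (f ⊗ g))))) detB)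
    where open Solver Δ

  unitDiagonal : ∀ {a b c d : PTerm Γ} → Δ ⊢ₚ Det (mat a b c d) → Δ ⊢ₚ b ⊗ c ≐ 𝟘 → Δ ⊢ₚ a ≐ 𝟙 ∧' d ≐ 𝟙
  unitDiagonal det bc≐𝟘 = ∧I (m⊗n≐𝟙⇒m≐𝟙 ad≐𝟙) (m⊗n≐𝟙⇒n≐𝟙 ad≐𝟙)
    where
    ad≐𝟙 = ≐trans det (≐trans (⊕-cong bc≐𝟘 (≐refl 𝟙)) (⊕-identityˡ 𝟙))

  Dom-c≐𝟘⇒≐I₂ : ∀ {A : Mat Γ} → Δ ⊢ₚ Dom A → Δ ⊢ₚ Mat.c A ≐ 𝟘 → Δ ⊢ₚ EqM A I₂
  Dom-c≐𝟘⇒≐I₂ {A = mat _ b _ _} dA c≐𝟘 = ∨E (∧E₂ dA)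
    (∧I (∧E₁ diag) (∧I (∧E₁ (hyp hd)) (∧I (weaken₁ c≐𝟘) (∧E₂ diag))))
    (⊥E (𝟙≰𝟘 (≼-trans (weaken₁ (m⊗n≐1+k⇒𝟙≼m (∧E₁ dA))) (≼-resp-≐ (≐refl _) (weaken₁ c≐𝟘) (∧E₁ (hyp hd))))))
    where
    diag = weaken₁ (unitDiagonal (∧E₁ dA) (n≐𝟘⇒m⊗n≐𝟘 b c≐𝟘))

  I₂-·ₘ : ∀ {A B : Mat Γ} → Δ ⊢ₚ EqM A I₂ → Δ ⊢ₚ EqM (A ·ₘ B) B
  I₂-·ₘ {B = mat e f g h} H = ∧I (row₁ e g) (∧I (row₁ f h) (∧I (row₂ e g) (row₂ f h)))
    where
    row₁ : ∀ x y → _ ⊢ₚ _ ⊗ x ⊕ _ ⊗ y ≐ x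
    row₁ x y = ≐trans (⊕-cong (⊗-cong (∧E₁ H) (≐refl x)) (m≐𝟘⇒m⊗n≐𝟘 y (∧E₁ (∧E₂ H))))
                      (≐trans (⊕-identityʳ _) (⊗-identityˡ x))
    row₂ : ∀ x y → _ ⊢ₚ _ ⊗ x ⊕ _ ⊗ y ≐ y
    row₂ x y = ≐trans (⊕-cong (m≐𝟘⇒m⊗n≐𝟘 x (∧E₁ (∧E₂ (∧E₂ H)))) (⊗-cong (∧E₂ (∧E₂ (∧E₂ H))) (≐refl y)))
                      (≐trans (⊕-identityˡ _) (⊗-identityˡ y))

  ·ₘ-I₂ : ∀ {A B : Mat Γ} → Δ ⊢ₚ EqM B I₂ → Δ ⊢ₚ EqM (A ·ₘ B) A
  ·ₘ-I₂ {A = mat a b c d} H = ∧I (col₁ a b) (∧I (col₂ a b) (∧I (col₁ c d) (col₂ c d)))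
    where
    col₁ : ∀ x y → _ ⊢ₚ x ⊗ _ ⊕ y ⊗ _ ≐ x
    col₁ x y = ≐trans (⊕-cong (⊗-cong (≐refl x) (∧E₁ H)) (n≐𝟘⇒m⊗n≐𝟘 y (∧E₁ (∧E₂ (∧E₂ H)))))
                      (≐trans (⊕-identityʳ _) (⊗-identityʳ x))
    col₂ : ∀ x y → _ ⊢ₚ x ⊗ _ ⊕ y ⊗ _ ≐ y
    col₂ x y = ≐trans (⊕-cong (n≐𝟘⇒m⊗n≐𝟘 x (∧E₁ (∧E₂ H))) (⊗-cong (≐refl y) (∧E₂ (∧E₂ (∧E₂ H)))))
                      (≐trans (⊕-identityˡ _) (⊗-identityʳ y))

  Dom-·ₘ : ∀ {A B : Mat Γ} → Δ ⊢ₚ Dom A → Δ ⊢ₚ Dom B → Δ ⊢ₚ Dom (A ·ₘ B)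
  Dom-·ₘ {B = mat e f g h} dA dB = ∧I (det-·ₘ (∧E₁ dA) (∧E₁ dB)) (∨E (∧E₂ dA)
    (Shape-resp-EqM (EqM-sym (I₂-·ₘ (Dom-c≐𝟘⇒≐I₂ (weaken₁ dA) (∧E₂ (hyp hd))))) (weaken₁ (∧E₂ dB)))
    (∨I₂ (∧I (⊕-mono-≼ (⊗-monoˡ-≼ e (∧E₁ (hyp hd))) (⊗-monoˡ-≼ g (∧E₂ (hyp hd))))
             (⊕-mono-≼ (⊗-monoˡ-≼ f (∧E₁ (hyp hd))) (⊗-monoˡ-≼ h (∧E₂ (hyp hd)))))))

  ·ₘ-congʳ : ∀ {A B : Mat Γ} (C : Mat Γ) → Δ ⊢ₚ EqM A B → Δ ⊢ₚ EqM (A ·ₘ C) (B ·ₘ C)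
  ·ₘ-congʳ (mat e f g h) H = ∧I (row a₌ b₌ e g) (∧I (row a₌ b₌ f h) (∧I (row c₌ d₌ e g) (row c₌ d₌ f h)))
    where
    a₌ = ∧E₁ H
    b₌ = ∧E₁ (∧E₂ H)
    c₌ = ∧E₁ (∧E₂ (∧E₂ H))
    d₌ = ∧E₂ (∧E₂ (∧E₂ H))
    row : ∀ {x y x' y'} → _ ⊢ₚ x ≐ x' → _ ⊢ₚ y ≐ y' → ∀ p q → _ ⊢ₚ x ⊗ p ⊕ y ⊗ q ≐ x' ⊗ p ⊕ y' ⊗ q
    row x₌ y₌ p q = ⊕-cong (⊗-cong x₌ (≐refl p)) (⊗-cong y₌ (≐refl q))

  det-resp-EqM : ∀ {A B : Mat Γ} → Δ ⊢ₚ EqM A B → Δ ⊢ₚ Det B → Δ ⊢ₚ Det A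
  det-resp-EqM H detB = ≐trans (⊗-cong (∧E₁ H) (∧E₂ (∧E₂ (∧E₂ H))))
    (≐trans detB (≐sym (⊕-cong (⊗-cong (∧E₁ (∧E₂ H)) (∧E₁ (∧E₂ (∧E₂ H)))) (≐refl 𝟙))))

  det-cancelˡ : ∀ {A Z : Mat Γ} → Δ ⊢ₚ Det A → Δ ⊢ₚ Det (A ·ₘ Z) → Δ ⊢ₚ Det Z
  det-cancelˡ {Δ = Δ} {mat a b c d} {mat z₁ z₂ z₃ z₄} detA detAZ =
    ≐-by-cancelling
      (solve 8 (λ a b c d z₁ z₂ z₃ z₄ →
          z₁ :* z₄ :+ ((a :* z₂ :+ b :* z₄) :* (c :* z₁ :+ d :* z₃) :+ con 1
                       :+ (a :* d) :* (z₁ :* z₄) :+ (b :* c :+ con 1) :* (z₂ :* z₃))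
       := z₂ :* z₃ :+ con 1 :+ ((a :* z₁ :+ b :* z₃) :* (c :* z₂ :+ d :* z₄)
                       :+ (b :* c :+ con 1) :* (z₁ :* z₄) :+ (a :* d) :* (z₂ :* z₃)))
       (≐refl _) a b c d z₁ z₂ z₃ z₄)
      (⊕-cong (⊕-cong detAZ (≐sym (⊗-cong detA (≐refl (z₁ ⊗ z₄))))) (⊗-cong detA (≐refl (z₂ ⊗ z₃))))
    where open Solver Δ

  private
    cancel-column : ∀ {a b c d x y x' y' : PTerm Γ} → Δ ⊢ₚ Det (mat a b c d) →
                    Δ ⊢ₚ a ⊗ x ⊕ b ⊗ y ≐ a ⊗ x' ⊕ b ⊗ y' → Δ ⊢ₚ c ⊗ x ⊕ d ⊗ y ≐ c ⊗ x' ⊕ d ⊗ y' →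
                    Δ ⊢ₚ x ≐ x' ∧' y ≐ y'
    cancel-column {Δ = Δ} {a} {b} {c} {d} {x} {y} {x'} {y'} detA H₁ H₂ = ∧I
      (≐-by-cancelling
        (solve 8 (λ a b c d x y x' y' →
            x :+ (d :* (a :* x' :+ b :* y') :+ b :* (c :* x :+ d :* y) :+ (a :* d) :* x :+ (b :* c :+ con 1) :* x')
         := x' :+ (d :* (a :* x :+ b :* y) :+ b :* (c :* x' :+ d :* y') :+ (b :* c :+ con 1) :* x :+ (a :* d) :* x'))
         (≐refl _) a b c d x y x' y')
        (⊕-cong (⊕-cong (⊕-cong (⊗-cong (≐refl d) H₁) (⊗-cong (≐refl b) (≐sym H₂))) (≐sym (⊗-cong detA (≐refl x))))
                (⊗-cong detA (≐refl x'))))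
      (≐-by-cancelling
        (solve 8 (λ a b c d x y x' y' →
            y :+ (a :* (c :* x' :+ d :* y') :+ c :* (a :* x :+ b :* y) :+ (a :* d) :* y :+ (b :* c :+ con 1) :* y')
         := y' :+ (a :* (c :* x :+ d :* y) :+ c :* (a :* x' :+ b :* y') :+ (b :* c :+ con 1) :* y :+ (a :* d) :* y'))
         (≐refl _) a b c d x y x' y')
        (⊕-cong (⊕-cong (⊕-cong (⊗-cong (≐refl a) H₂) (⊗-cong (≐refl c) (≐sym H₁))) (≐sym (⊗-cong detA (≐refl y))))
                (⊗-cong detA (≐refl y'))))
      where open Solver Δ

  ·ₘ-cancelˡ : ∀ {A X Y : Mat Γ} → Δ ⊢ₚ Det A → Δ ⊢ₚ EqM (A ·ₘ X) (A ·ₘ Y) → Δ ⊢ₚ EqM X Y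
  ·ₘ-cancelˡ {A = mat a b c d} detA H = ∧I (∧E₁ col₁) (∧I (∧E₁ col₂) (∧I (∧E₂ col₁) (∧E₂ col₂)))
    where
    col₁ = cancel-column detA (∧E₁ H) (∧E₁ (∧E₂ (∧E₂ H)))
    col₂ = cancel-column detA (∧E₁ (∧E₂ H)) (∧E₂ (∧E₂ (∧E₂ H)))

  -- With z = adj(A)·(p, q) computed by subtraction, A·z = (p, q) since det A = 1.
  adjugate-column : ∀ {a b c d p q z₁ z₂ : PTerm Γ} → Δ ⊢ₚ Det (mat a b c d) →
                    Δ ⊢ₚ p ⊗ d ≐ q ⊗ b ⊕ z₁ → Δ ⊢ₚ a ⊗ q ≐ c ⊗ p ⊕ z₂ →
                    Δ ⊢ₚ a ⊗ z₁ ⊕ b ⊗ z₂ ≐ p ∧' c ⊗ z₁ ⊕ d ⊗ z₂ ≐ q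
  adjugate-column {Δ = Δ} {a} {b} {c} {d} {p} {q} {z₁} {z₂} detA e₁ e₂ = ∧I
    (≐-by-cancelling
      (solve 8 (λ a b c d p q z₁ z₂ → a :* z₁ :+ b :* z₂ :+ (p :* (b :* c :+ con 1) :+ a :* (p :* d) :+ b :* (a :* q))
                                    := p :+ (p :* (a :* d) :+ a :* (q :* b :+ z₁) :+ b :* (c :* p :+ z₂)))
        (≐refl _) a b c d p q z₁ z₂)
      (⊕-cong (⊕-cong (⊗-cong (≐refl p) detA) (≐sym (⊗-cong (≐refl a) e₁))) (≐sym (⊗-cong (≐refl b) e₂))))
    (≐-by-cancelling
      (solve 8 (λ a b c d p q z₁ z₂ → c :* z₁ :+ d :* z₂ :+ (q :* (b :* c :+ con 1) :+ c :* (p :* d) :+ d :* (a :* q))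
                                    := q :+ (q :* (a :* d) :+ c :* (q :* b :+ z₁) :+ d :* (c :* p :+ z₂)))
        (≐refl _) a b c d p q z₁ z₂)
      (⊕-cong (⊕-cong (⊗-cong (≐refl q) detA) (≐sym (⊗-cong (≐refl c) e₁))) (≐sym (⊗-cong (≐refl d) e₂))))
    where open Solver Δ

  ·ₘ-assoc : ∀ (A B C : Mat Γ) → Δ ⊢ₚ EqM ((A ·ₘ B) ·ₘ C) (A ·ₘ (B ·ₘ C))
  ·ₘ-assoc {Δ = Δ} (mat a b c d) (mat e f g h) (mat i j k l) =
    ∧I (entry a b i k) (∧I (entry a b j l) (∧I (entry c d i k) (entry c d j l)))
    where
    open Solver Δ
    entry : ∀ x y p q → Δ ⊢ₚ (x ⊗ e ⊕ y ⊗ g) ⊗ p ⊕ (x ⊗ f ⊕ y ⊗ h) ⊗ q ≐ x ⊗ (e ⊗ p ⊕ f ⊗ q) ⊕ y ⊗ (g ⊗ p ⊕ h ⊗ q)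
    entry x y p q = solve 8 (λ x y e f g h p q →
        (x :* e :+ y :* g) :* p :+ (x :* f :+ y :* h) :* q := x :* (e :* p :+ f :* q) :+ y :* (g :* p :+ h :* q))
      (≐refl _) x y e f g h p q

  ·ₘ≐I₂⇒≐I₂ : ∀ {A B : Mat Γ} → Δ ⊢ₚ Dom A → Δ ⊢ₚ Dom B → Δ ⊢ₚ EqM (A ·ₘ B) I₂ → Δ ⊢ₚ EqM A I₂ ∧' EqM B I₂
  ·ₘ≐I₂⇒≐I₂ dA dB H = ∧I
    (Dom-c≐𝟘⇒≐I₂ dA (m⊗n≐𝟘⇒m≐𝟘 (m⊗n≐1+k⇒𝟙≼m (∧E₁ dB)) (m⊕n≐𝟘⇒m≐𝟘 entry₂₁)))
    (Dom-c≐𝟘⇒≐I₂ dB (m⊗n≐𝟘⇒n≐𝟘 (m⊗n≐1+k⇒𝟙≼n (∧E₁ dA)) (m⊕n≐𝟘⇒n≐𝟘 entry₂₁)))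
    where
    entry₂₁ = ∧E₁ (∧E₂ (∧E₂ H))

  atom-irreducible : ∀ {A B : Mat Γ} → Δ ⊢ₚ Dom A → Δ ⊢ₚ Dom B →
                     Δ ⊢ₚ Mat.c (A ·ₘ B) ≐ 𝟙 → Δ ⊢ₚ EqM A I₂ ∨' EqM B I₂
  atom-irreducible {A = mat a b c d} {mat e f g h} dA dB H = ∨E (zero∨positive g)
    (∨I₂ (Dom-c≐𝟘⇒≐I₂ (weaken₁ dB) (hyp hd)))
    (∨I₁ (Dom-c≐𝟘⇒≐I₂ (weaken₁ dA) (m⊗n≐𝟘⇒m≐𝟘 (weaken₁ (m⊗n≐1+k⇒𝟙≼m (∧E₁ dB))) ce≐𝟘)))
    where
    ce≐𝟘 : _ ⊢ₚ c ⊗ e ≐ 𝟘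
    ce≐𝟘 = ≼-antisym
      (⊕-cancelʳ-≼ 𝟙 (≼-trans (⊕-monoʳ-≼ (c ⊗ e) (⊗-positive (weaken₁ (m⊗n≐1+k⇒𝟙≼n (∧E₁ dA))) (hyp hd)))
                               (≐⇒≼ (≐trans (weaken₁ H) (≐sym (⊕-identityˡ 𝟙))))))
      (𝟘≼ _)

  square-gap : ∀ {s t u x : PTerm Γ} → Δ ⊢ₚ s ⊕ 𝟙 ≼ t → Δ ⊢ₚ t ⊗ t ⊕ u ≐ s ⊗ s ⊕ x → Δ ⊢ₚ x ≼ s → Δ ⊢ₚ ⊥'
  square-gap {Δ = Δ} {s} {t} {u} {x} s<t e x≼s =
    1+n≰n (≼-trans (≐≼≐ (solve 1 (λ s → ((s :* s :+ s) :+ s) :+ con 1 := (s :+ con 1) :* (s :+ con 1)) (≐refl _) s)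
                        (≼-trans (⊗-mono-≼ s<t s<t)
                          (≼-trans (m≼m⊕n (t ⊗ t) u) (≼-trans (≐⇒≼ e) (⊕-monoʳ-≼ (s ⊗ s) x≼s))))
                        (≐refl _))
                   (m≼m⊕n (s ⊗ s ⊕ s) s))
    where open Solver Δ

  pair-injective : ∀ {x y u v : PTerm Γ} → Δ ⊢ₚ pair x y ≐ pair u v → Δ ⊢ₚ x ≐ u ∧' y ≐ v
  pair-injective {x = x} {y} {u} {v} H = ∧I x≐u (⊕-cancelˡ-≐ u (≐trans (⊕-cong (≐sym x≐u) (≐refl y)) sums≐))
    where
    sums≐ = ∨E (≼∨> (x ⊕ y) (u ⊕ v))
      (∨E (≼-discrete (hyp hd)) (hyp hd) (⊥E (square-gap (hyp hd) (≐sym (weaken₁ (weaken₁ H))) (m≼m⊕n x y))))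
      (⊥E (square-gap (hyp hd) (weaken₁ H) (m≼m⊕n u v)))
    x≐u = ⊕-cancelˡ-≐ _ (≐trans (⊕-cong (⊗-cong (≐sym sums≐) (≐sym sums≐)) (≐refl x)) H)

  Fθ-injective : ∀ {A B : Mat Γ} → Δ ⊢ₚ Fθ A ≐ Fθ B → Δ ⊢ₚ EqM A B
  Fθ-injective H = ∧I (∧E₁ h₁) (∧I (∧E₁ h₂) (∧I (∧E₁ h₃) (∧E₂ h₃)))
    where
    h₁ = pair-injective H
    h₂ = pair-injective (∧E₂ h₁)
    h₃ = pair-injective (∧E₂ h₂)

module SlopeOrder where

  open import Data.List using (List)
  open import Data.Unit using (⊤)
  open PAminusReasoning
  open PAminusOrder
  open Matrices using (Det)

  private variable
    Γ : List ⊤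
    Δ : List (PFormula Γ)

  record Vec₂ (Γ : List ⊤) : Set where
    constructor ⟨_,_⟩
    field x y : PTerm Γ

  col₁ col₂ : Mat Γ → Vec₂ Γ
  col₁ (mat a b c d) = ⟨ a , c ⟩
  col₂ (mat a b c d) = ⟨ b , d ⟩

  infixr 7 _·ᵥ_
  infix  4 _⊑_ _⊏_

  _·ᵥ_ : Mat Γ → Vec₂ Γ → Vec₂ Γ
  mat a b c d ·ᵥ ⟨ x , y ⟩ = ⟨ a ⊗ x ⊕ b ⊗ y , c ⊗ x ⊕ d ⊗ y ⟩

  -- u ⊑ v says that the slope u.y / u.x is at most v.y / v.x, without division.
  _⊑_ _⊏_ : Vec₂ Γ → Vec₂ Γ → PFormula Γ
  ⟨ x₁ , y₁ ⟩ ⊑ ⟨ x₂ , y₂ ⟩ = y₁ ⊗ x₂ ≼ x₁ ⊗ y₂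
  ⟨ x₁ , y₁ ⟩ ⊏ ⟨ x₂ , y₂ ⟩ = y₁ ⊗ x₂ ⊕ 𝟙 ≼ x₁ ⊗ y₂

  ⊏⇒⊑ : ∀ {u v : Vec₂ Γ} → Δ ⊢ₚ u ⊏ v → Δ ⊢ₚ u ⊑ v
  ⊏⇒⊑ = <⇒≼

  ⊏∨⊒ : ∀ (u v : Vec₂ Γ) → Δ ⊢ₚ u ⊏ v ∨' v ⊑ u
  ⊏∨⊒ ⟨ x₁ , y₁ ⟩ ⟨ x₂ , y₂ ⟩ = ∨E (≼∨> (y₂ ⊗ x₁) (x₂ ⊗ y₁))
    (∨I₂ (hyp hd))
    (∨I₁ (≼-resp-≐ (⊕-cong (⊗-comm x₂ y₁) (≐refl 𝟙)) (⊗-comm y₂ x₁) (hyp hd)))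

  ⊑⇒⊏∨⊒ : ∀ {u v : Vec₂ Γ} → Δ ⊢ₚ u ⊑ v → Δ ⊢ₚ u ⊏ v ∨' v ⊑ u
  ⊑⇒⊏∨⊒ {u = ⟨ x₁ , y₁ ⟩} {⟨ x₂ , y₂ ⟩} u⊑v = ∨E (≼-discrete u⊑v)
    (∨I₂ (≐⇒≼ (≐trans (⊗-comm y₂ x₁) (≐trans (≐sym (hyp hd)) (⊗-comm y₁ x₂)))))
    (∨I₁ (hyp hd))

  ⊏-asym : ∀ {u v : Vec₂ Γ} → Δ ⊢ₚ u ⊏ v → Δ ⊢ₚ v ⊑ u → Δ ⊢ₚ ⊥'
  ⊏-asym {u = ⟨ x₁ , y₁ ⟩} {⟨ x₂ , y₂ ⟩} u⊏v v⊑u =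
    1+n≰n (≼-trans u⊏v (≐≼≐ (⊗-comm x₁ y₂) v⊑u (⊗-comm x₂ y₁)))

  ⊑-resp-≐ : ∀ {x₁ y₁ x₂ y₂ x₁' y₁' x₂' y₂' : PTerm Γ} →
             Δ ⊢ₚ x₁ ≐ x₁' → Δ ⊢ₚ y₁ ≐ y₁' → Δ ⊢ₚ x₂ ≐ x₂' → Δ ⊢ₚ y₂ ≐ y₂' →
             Δ ⊢ₚ ⟨ x₁ , y₁ ⟩ ⊑ ⟨ x₂ , y₂ ⟩ → Δ ⊢ₚ ⟨ x₁' , y₁' ⟩ ⊑ ⟨ x₂' , y₂' ⟩
  ⊑-resp-≐ e₁ f₁ e₂ f₂ = ≼-resp-≐ (⊗-cong f₁ e₂) (⊗-cong e₁ f₂)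

  private
    ⊑-trans-positive : ∀ {u v w : Vec₂ Γ} → Δ ⊢ₚ 𝟙 ≼ Vec₂.x v → Δ ⊢ₚ 𝟙 ≼ Vec₂.y v →
                       Δ ⊢ₚ u ⊑ v → Δ ⊢ₚ v ⊑ w → Δ ⊢ₚ u ⊑ w
    ⊑-trans-positive {Δ = Δ} {⟨ x₁ , y₁ ⟩} {⟨ x₂ , y₂ ⟩} {⟨ x₃ , y₃ ⟩} p q u⊑v v⊑w =
      ⊗-cancelʳ-≼ (⊗-positive p q) (≐≼≐ (regroup y₁ x₂ y₂ x₃) (⊗-mono-≼ u⊑v v⊑w) (regroup′ x₁ x₂ y₂ y₃))
      where
      open Solver Δ
      regroup : ∀ p q r s → Δ ⊢ₚ (p ⊗ s) ⊗ (q ⊗ r) ≐ (p ⊗ q) ⊗ (r ⊗ s)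
      regroup = solve 4 (λ p q r s → (p :* s) :* (q :* r) := (p :* q) :* (r :* s)) (≐refl _)
      regroup′ : ∀ p q r s → Δ ⊢ₚ (p ⊗ r) ⊗ (q ⊗ s) ≐ (p ⊗ s) ⊗ (q ⊗ r)
      regroup′ = solve 4 (λ p q r s → (p :* r) :* (q :* s) := (p :* s) :* (q :* r)) (≐refl _)

  ⊑-trans-x : ∀ {u v w : Vec₂ Γ} → Δ ⊢ₚ 𝟙 ≼ Vec₂.x v → Δ ⊢ₚ u ⊑ v → Δ ⊢ₚ v ⊑ w → Δ ⊢ₚ u ⊑ w
  ⊑-trans-x {u = ⟨ x₁ , y₁ ⟩} {⟨ x₂ , y₂ ⟩} {⟨ x₃ , y₃ ⟩} p u⊑v v⊑w = ∨E (zero∨positive y₂)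
    (≐≼≐ (m≐𝟘⇒m⊗n≐𝟘 x₃ y₁≐𝟘) (𝟘≼ (x₁ ⊗ y₃)) (≐refl _))
    (⊑-trans-positive (weaken₁ p) (hyp hd) (weaken₁ u⊑v) (weaken₁ v⊑w))
    where
    y₁≐𝟘 = m⊗n≐𝟘⇒m≐𝟘 (weaken₁ p)
      (≼-antisym (≼-trans (weaken₁ u⊑v) (≐⇒≼ (n≐𝟘⇒m⊗n≐𝟘 x₁ (hyp hd)))) (𝟘≼ _))

  ⊑-trans-y : ∀ {u v w : Vec₂ Γ} → Δ ⊢ₚ 𝟙 ≼ Vec₂.y v → Δ ⊢ₚ u ⊑ v → Δ ⊢ₚ v ⊑ w → Δ ⊢ₚ u ⊑ w
  ⊑-trans-y {u = ⟨ x₁ , y₁ ⟩} {⟨ x₂ , y₂ ⟩} {⟨ x₃ , y₃ ⟩} q u⊑v v⊑w = ∨E (zero∨positive x₂)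
    (≐≼≐ (n≐𝟘⇒m⊗n≐𝟘 y₁ x₃≐𝟘) (𝟘≼ (x₁ ⊗ y₃)) (≐refl _))
    (⊑-trans-positive (hyp hd) (weaken₁ q) (weaken₁ u⊑v) (weaken₁ v⊑w))
    where
    x₃≐𝟘 = m⊗n≐𝟘⇒n≐𝟘 (weaken₁ q)
      (≼-antisym (≼-trans (weaken₁ v⊑w) (≐⇒≼ (m≐𝟘⇒m⊗n≐𝟘 y₃ (hyp hd)))) (𝟘≼ _))

  col₁⊏col₂ : ∀ {A : Mat Γ} → Δ ⊢ₚ Det A → Δ ⊢ₚ col₁ A ⊏ col₂ A
  col₁⊏col₂ {A = mat a b c d} det = ≐≼≐ (⊕-cong (⊗-comm c b) (≐refl 𝟙)) (≼-refl _) (≐sym det)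

  col₁⊑·ᵥ : ∀ {A : Mat Γ} → Δ ⊢ₚ Det A → ∀ v → Δ ⊢ₚ col₁ A ⊑ A ·ᵥ v
  col₁⊑·ᵥ {Δ = Δ} {mat a b c d} det ⟨ x , y ⟩ = ≐≼≐ (≐refl _) (m≼m⊕n (c ⊗ (a ⊗ x ⊕ b ⊗ y)) y) (≐sym expand)
    where
    open Solver Δ
    expand : Δ ⊢ₚ a ⊗ (c ⊗ x ⊕ d ⊗ y) ≐ c ⊗ (a ⊗ x ⊕ b ⊗ y) ⊕ y
    expand = ≐-by-cancelling
      (solve 6 (λ a b c d x y → a :* (c :* x :+ d :* y) :+ (b :* c :+ con 1) :* y
                               := c :* (a :* x :+ b :* y) :+ y :+ (a :* d) :* y) (≐refl _) a b c d x y)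
      (⊗-cong det (≐refl y))

  ·ᵥ⊑col₂ : ∀ {A : Mat Γ} → Δ ⊢ₚ Det A → ∀ v → Δ ⊢ₚ A ·ᵥ v ⊑ col₂ A
  ·ᵥ⊑col₂ {Δ = Δ} {mat a b c d} det ⟨ x , y ⟩ = ≐≼≐ (≐refl _) (m≼m⊕n ((c ⊗ x ⊕ d ⊗ y) ⊗ b) x) (≐sym expand)
    where
    open Solver Δ
    expand : Δ ⊢ₚ (a ⊗ x ⊕ b ⊗ y) ⊗ d ≐ (c ⊗ x ⊕ d ⊗ y) ⊗ b ⊕ x
    expand = ≐-by-cancelling
      (solve 6 (λ a b c d x y → (a :* x :+ b :* y) :* d :+ (b :* c :+ con 1) :* x
                               := (c :* x :+ d :* y) :* b :+ x :+ (a :* d) :* x) (≐refl _) a b c d x y)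
      (⊗-cong det (≐refl x))

  gap-product : ∀ {N₁ N₂ P₁ P₂ : PTerm Γ} → Δ ⊢ₚ N₁ ⊕ 𝟙 ≼ P₁ → Δ ⊢ₚ N₂ ⊕ 𝟙 ≼ P₂ →
                Δ ⊢ₚ P₁ ⊗ N₂ ⊕ N₁ ⊗ P₂ ⊕ 𝟙 ≼ P₁ ⊗ P₂ ⊕ N₁ ⊗ N₂
  gap-product N₁<P₁ N₂<P₂ =
    ∃E (subtraction N₁<P₁) (∃E (subtraction (weakenCtx N₂<P₂)) (gaps (weakenCtx (hyp hd)) (hyp hd)))
    where
    gaps : ∀ {Γ} {Δ : List (PFormula Γ)} {N₁ N₂ P₁ P₂ s t : PTerm Γ} →
           Δ ⊢ₚ P₁ ≐ (N₁ ⊕ 𝟙) ⊕ s → Δ ⊢ₚ P₂ ≐ (N₂ ⊕ 𝟙) ⊕ t →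
           Δ ⊢ₚ P₁ ⊗ N₂ ⊕ N₁ ⊗ P₂ ⊕ 𝟙 ≼ P₁ ⊗ P₂ ⊕ N₁ ⊗ N₂
    gaps {Δ = Δ} {N₁} {N₂} {P₁} {P₂} {s} {t} e₁ e₂ =
      ≐≼≐ (⊕-cong (⊕-cong (⊗-cong e₁ (≐refl N₂)) (⊗-cong (≐refl N₁) e₂)) (≐refl 𝟙))
          (≐≼≐ (≐refl _) (m≼m⊕n _ (s ⊕ t ⊕ s ⊗ t)) (solve 4 (λ N₁ N₂ s t →
               ((N₁ :+ con 1) :+ s) :* N₂ :+ N₁ :* ((N₂ :+ con 1) :+ t) :+ con 1 :+ (s :+ t :+ s :* t)
            := ((N₁ :+ con 1) :+ s) :* ((N₂ :+ con 1) :+ t) :+ N₁ :* N₂) (≐refl _) N₁ N₂ s t))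
          (≐sym (⊕-cong (⊗-cong e₁ e₂) (≐refl _)))
      where open Solver Δ

module Cones where

  open import Data.List using (List; _∷_)
  open import Data.Unit using (⊤)
  open PAminusReasoning
  open PAminusOrder
  open Matrices
  open SlopeOrder

  private variable
    Γ : List ⊤
    Δ : List (PFormula Γ)

  infix 4 cone_⊆cone_

  cone_⊆cone_ : Mat Γ → Mat Γ → PFormula Γ
  cone C ⊆cone A = (col₁ A ⊑ col₁ C ∧' col₁ C ⊑ col₂ A) ∧' (col₁ A ⊑ col₂ C ∧' col₂ C ⊑ col₂ A)

  plücker : ∀ {a b c d a' b' c' d' : PTerm Γ} → Δ ⊢ₚ Det (mat a b c d) → Δ ⊢ₚ Det (mat a' b' c' d') →
            Δ ⊢ₚ ((a ⊗ c') ⊗ (b ⊗ d') ⊕ (c ⊗ a') ⊗ (d ⊗ b')) ⊕ ((a ⊗ d') ⊗ (a' ⊗ d) ⊕ (c ⊗ b') ⊗ (c' ⊗ b))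
               ≐ (((a ⊗ c') ⊗ (d ⊗ b') ⊕ (c ⊗ a') ⊗ (b ⊗ d')) ⊕ ((a ⊗ d') ⊗ (c' ⊗ b) ⊕ (c ⊗ b') ⊗ (a' ⊗ d))) ⊕ 𝟙
  plücker {Δ = Δ} {a} {b} {c} {d} {a'} {b'} {c'} {d'} detA detC =
    ≐-by-cancelling
      (solve 8 (λ a b c d a' b' c' d' →
          ((a :* c') :* (b :* d') :+ (c :* a') :* (d :* b')) :+ ((a :* d') :* (a' :* d) :+ (c :* b') :* (c' :* b))
            :+ ((b :* c :+ con 1) :* (a' :* d') :+ (a :* d) :* (b' :* c') :+ (b' :* c' :+ con 1))
       := (((a :* c') :* (d :* b') :+ (c :* a') :* (b :* d')) :+ ((a :* d') :* (c' :* b) :+ (c :* b') :* (a' :* d))) :+ con 1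
            :+ ((a :* d) :* (a' :* d') :+ (b :* c :+ con 1) :* (b' :* c') :+ a' :* d'))
       (≐refl _) a b c d a' b' c' d')
      (⊕-cong (⊕-cong (⊗-cong detA (≐refl (a' ⊗ d'))) (≐sym (⊗-cong detA (≐refl (b' ⊗ c'))))) detC)
    where open Solver Δ

  -- The two gap products add up to more than the Plücker identity allows.
  cones-cannot-cross : ∀ {A C : Mat Γ} → Δ ⊢ₚ Dom A → Δ ⊢ₚ Dom C →
                       Δ ⊢ₚ col₁ A ⊏ col₁ C → Δ ⊢ₚ col₂ A ⊏ col₂ C →
                       Δ ⊢ₚ col₁ A ⊏ col₂ C → Δ ⊢ₚ col₁ C ⊏ col₂ A → Δ ⊢ₚ ⊥'
  cones-cannot-cross {Δ = Δ} dA dC 1A⊏1C 2A⊏2C 1A⊏2C 1C⊏2A =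
    1+n≰n (≐≼≐ (solve 2 (λ x y → ((x :+ y) :+ con 1) :+ con 1 := (x :+ con 1) :+ (y :+ con 1)) (≐refl _) _ _)
               (⊕-mono-≼ (gap-product 1A⊏1C 2A⊏2C) (gap-product 1A⊏2C 1C⊏2A))
               (plücker (∧E₁ dA) (∧E₁ dC)))
    where open Solver Δ

  module _ {A B C D : Mat Γ} (dA : Δ ⊢ₚ Dom A) (dB : Δ ⊢ₚ Dom B) (dC : Δ ⊢ₚ Dom C)
           (H : Δ ⊢ₚ EqM (A ·ₘ B) (C ·ₘ D)) where

    private
      M = A ·ₘ B

      detM = det-·ₘ (∧E₁ dA) (∧E₁ dB)

      CD-to-M₁ : ∀ {u} → Δ ⊢ₚ u ⊑ col₁ (C ·ₘ D) → Δ ⊢ₚ u ⊑ col₁ M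
      CD-to-M₁ = ⊑-resp-≐ (≐refl _) (≐refl _) (≐sym (∧E₁ H)) (≐sym (∧E₁ (∧E₂ (∧E₂ H))))

      CD-to-M₂ : ∀ {u} → Δ ⊢ₚ col₂ (C ·ₘ D) ⊑ u → Δ ⊢ₚ col₂ M ⊑ u
      CD-to-M₂ = ⊑-resp-≐ (≐sym (∧E₁ (∧E₂ H))) (≐sym (∧E₂ (∧E₂ (∧E₂ H)))) (≐refl _) (≐refl _)

      1M⊏2M : Δ ⊢ₚ col₁ M ⊏ col₂ M
      1M⊏2M = col₁⊏col₂ detM

      1A⊑1M : Δ ⊢ₚ col₁ A ⊑ col₁ M
      1A⊑1M = col₁⊑·ᵥ (∧E₁ dA) (col₁ B)

      2M⊑2A : Δ ⊢ₚ col₂ M ⊑ col₂ A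
      2M⊑2A = ·ᵥ⊑col₂ (∧E₁ dA) (col₂ B)

      1C⊑1M : Δ ⊢ₚ col₁ C ⊑ col₁ M
      1C⊑1M = CD-to-M₁ (col₁⊑·ᵥ (∧E₁ dC) (col₁ D))

      2M⊑2C : Δ ⊢ₚ col₂ M ⊑ col₂ C
      2M⊑2C = CD-to-M₂ (·ᵥ⊑col₂ (∧E₁ dC) (col₂ D))

      -- col₁ X ⊑ col₁ M ⊏ col₂ M ⊑ col₂ Y, and the middle step is strict because det M = 1.
      through-M : ∀ {X Y} → Δ ⊢ₚ Dom X → Δ ⊢ₚ Dom Y →
                  Δ ⊢ₚ col₁ X ⊑ col₁ M → Δ ⊢ₚ col₂ M ⊑ col₂ Y → Δ ⊢ₚ col₁ X ⊏ col₂ Y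
      through-M dX dY 1X⊑1M 2M⊑2Y = ∨E (⊑⇒⊏∨⊒ (⊑-trans-y M₂₂≥1 (⊑-trans-x M₁₁≥1 1X⊑1M (⊏⇒⊑ 1M⊏2M)) 2M⊑2Y))
        (hyp hd)
        (⊥E (⊏-asym (weaken₁ 1M⊏2M)
               (⊑-trans-x (weaken₁ (m⊗n≐1+k⇒𝟙≼m (∧E₁ dX)))
                  (⊑-trans-y (weaken₁ (m⊗n≐1+k⇒𝟙≼n (∧E₁ dY))) (weaken₁ 2M⊑2Y) (hyp hd)) (weaken₁ 1X⊑1M))))
        where
        M₁₁≥1 = m⊗n≐1+k⇒𝟙≼m detM
        M₂₂≥1 = m⊗n≐1+k⇒𝟙≼n detM

      1A⊏2C : Δ ⊢ₚ col₁ A ⊏ col₂ C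
      1A⊏2C = through-M dA dC 1A⊑1M 2M⊑2C

      1C⊏2A : Δ ⊢ₚ col₁ C ⊏ col₂ A
      1C⊏2A = through-M dC dA 1C⊑1M 2M⊑2A

      C-inside-A : ∀ {Δ'} → Δ ⊆ʰ Δ' → Δ' ⊢ₚ col₁ A ⊑ col₁ C → Δ' ⊢ₚ col₂ C ⊑ col₂ A → Δ' ⊢ₚ cone C ⊆cone A
      C-inside-A w 1A⊑1C 2C⊑2A = ∧I (∧I 1A⊑1C (⊏⇒⊑ (weakenHyps w 1C⊏2A))) (∧I (⊏⇒⊑ (weakenHyps w 1A⊏2C)) 2C⊑2A)

      A-inside-C : ∀ {Δ'} → Δ ⊆ʰ Δ' → Δ' ⊢ₚ col₁ C ⊑ col₁ A → Δ' ⊢ₚ col₂ A ⊑ col₂ C → Δ' ⊢ₚ cone A ⊆cone C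
      A-inside-C w 1C⊑1A 2A⊑2C = ∧I (∧I 1C⊑1A (⊏⇒⊑ (weakenHyps w 1A⊏2C))) (∧I (⊏⇒⊑ (weakenHyps w 1C⊏2A)) 2A⊑2C)

      crossing-AC : ∀ {Δ' φ} → Δ ⊆ʰ Δ' → Δ' ⊢ₚ col₁ A ⊏ col₁ C → Δ' ⊢ₚ col₂ A ⊏ col₂ C → Δ' ⊢ₚ φ
      crossing-AC w p q =
        ⊥E (cones-cannot-cross (weakenHyps w dA) (weakenHyps w dC) p q (weakenHyps w 1A⊏2C) (weakenHyps w 1C⊏2A))

      crossing-CA : ∀ {Δ' φ} → Δ ⊆ʰ Δ' → Δ' ⊢ₚ col₁ C ⊏ col₁ A → Δ' ⊢ₚ col₂ C ⊏ col₂ A → Δ' ⊢ₚ φ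
      crossing-CA w p q =
        ⊥E (cones-cannot-cross (weakenHyps w dC) (weakenHyps w dA) p q (weakenHyps w 1C⊏2A) (weakenHyps w 1A⊏2C))

      ↑² : ∀ {Γ'} {Δ' : List (PFormula Γ')} {φ χ} → Δ' ⊆ʰ (φ ∷ χ ∷ Δ')
      ↑² h = tl (tl h)

      ↑³ : ∀ {Γ'} {Δ' : List (PFormula Γ')} {φ χ ψ} → Δ' ⊆ʰ (φ ∷ χ ∷ ψ ∷ Δ')
      ↑³ h = tl (tl (tl h))

    cones-nest : Δ ⊢ₚ cone C ⊆cone A ∨' cone A ⊆cone C
    cones-nest = ∨E (⊏∨⊒ (col₁ A) (col₁ C))
      (∨E (⊏∨⊒ (col₂ C) (col₂ A))
        (∨I₁ (C-inside-A ↑² (⊏⇒⊑ (hyp (tl hd))) (⊏⇒⊑ (hyp hd))))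
        (∨E (⊑⇒⊏∨⊒ (hyp hd))
          (crossing-AC ↑³ (hyp (tl (tl hd))) (hyp hd))
          (∨I₁ (C-inside-A ↑³ (⊏⇒⊑ (hyp (tl (tl hd)))) (hyp hd)))))
      (∨E (⊏∨⊒ (col₂ C) (col₂ A))
        (∨E (⊑⇒⊏∨⊒ (hyp (tl hd)))
          (crossing-CA ↑³ (hyp hd) (hyp (tl hd)))
          (∨I₁ (C-inside-A ↑³ (hyp hd) (⊏⇒⊑ (hyp (tl hd))))))
        (∨I₂ (A-inside-C ↑² (hyp (tl hd)) (hyp hd))))

module EditorWitness where

  open import Data.List using (List; _∷_)
  open import Data.Unit using (⊤)
  open PAminusReasoning
  open PAminusOrder
  open Matrices

  private variable
    Γ : List ⊤
    Δ : List (PFormula Γ)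

  Dom⇒row₂⋠row₁ : ∀ {B : Mat Γ} → Δ ⊢ₚ Dom B → Δ ⊢ₚ Mat.c B ≼ Mat.a B → Δ ⊢ₚ Mat.d B ≼ Mat.b B → Δ ⊢ₚ ⊥'
  Dom⇒row₂⋠row₁ {B = mat e f g h} dB g≼e h≼f = ∨E (∧E₂ dB)
    (𝟙≰𝟘 (≐≼≐ (≐sym (∧E₂ (unitDiagonal (weaken₁ (∧E₁ dB)) (m≐𝟘⇒m⊗n≐𝟘 g (∧E₁ (hyp hd))))))
              (weaken₁ h≼f) (∧E₁ (hyp hd))))
    (1+n≰n (≐⇒≼ (≐sym (≐trans (weaken₁ (∧E₁ dB)) (⊕-cong (≐trans (⊗-cong f≐h (≐sym e≐g)) (⊗-comm h e)) (≐refl 𝟙))))))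
    where
    e≐g = ≼-antisym (∧E₁ (hyp hd)) (weaken₁ g≼e)
    f≐h = ≼-antisym (∧E₂ (hyp hd)) (weaken₁ h≼f)

  a≼c⇒b≼d : ∀ {Z : Mat Γ} → Δ ⊢ₚ Det Z → Δ ⊢ₚ Mat.a Z ≼ Mat.c Z → Δ ⊢ₚ Mat.b Z ≼ Mat.d Z
  a≼c⇒b≼d {Δ = Δ} {mat z₁ z₂ z₃ z₄} detZ z₁≼z₃ = ∨E (≼∨> z₂ z₄) (hyp hd)
    (⊥E (1+n≰n (≼-trans
      (≐≼≐ (≐trans (solve 2 (λ x z₃ → (x :+ z₃) :+ con 1 := (x :+ con 1) :+ z₃) (≐refl _) (z₂ ⊗ z₃) z₃)
                   (⊕-cong (≐sym (weaken₁ detZ)) (≐refl z₃)))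
           (≼-trans (⊕-monoˡ-≼ z₃ (⊗-monoˡ-≼ z₄ (weaken₁ z₁≼z₃)))
                    (≐≼≐ (solve 2 (λ z₃ z₄ → z₃ :* z₄ :+ z₃ := z₃ :* (z₄ :+ con 1)) (≐refl _) z₃ z₄)
                         (⊗-monoʳ-≼ z₃ (hyp hd)) (⊗-comm z₃ z₂)))
           (≐refl _))
      (m≼m⊕n (z₂ ⊗ z₃) z₃))))
    where open Solver (_ ∷ Δ)

  c<a∧b<d⇒b≐𝟘∧c≐𝟘 : ∀ {Z : Mat Γ} → Δ ⊢ₚ Det Z → Δ ⊢ₚ Mat.c Z ⊕ 𝟙 ≼ Mat.a Z → Δ ⊢ₚ Mat.b Z ⊕ 𝟙 ≼ Mat.d Z →
                     Δ ⊢ₚ Mat.b Z ≐ 𝟘 ∧' Mat.c Z ≐ 𝟘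
  c<a∧b<d⇒b≐𝟘∧c≐𝟘 {Δ = Δ} {mat z₁ z₂ z₃ z₄} detZ z₃<z₁ z₂<z₄ = ∧I (m⊕n≐𝟘⇒m≐𝟘 sum≐𝟘) (m⊕n≐𝟘⇒n≐𝟘 sum≐𝟘)
    where
    open Solver Δ
    sum≐𝟘 : Δ ⊢ₚ z₂ ⊕ z₃ ≐ 𝟘
    sum≐𝟘 = ≼-antisym
      (⊕-cancelʳ-≼ (z₂ ⊗ z₃ ⊕ 𝟙)
        (≐≼≐ (solve 2 (λ z₂ z₃ → (z₂ :+ z₃) :+ (z₂ :* z₃ :+ con 1) := (z₃ :+ con 1) :* (z₂ :+ con 1)) (≐refl _) z₂ z₃)
             (⊗-mono-≼ z₃<z₁ z₂<z₄)
             (≐trans detZ (≐sym (⊕-identityˡ _)))))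
      (𝟘≼ _)

  rows-decreasing⇒⊥ : ∀ {B Z D : Mat Γ} → Δ ⊢ₚ Dom B → Δ ⊢ₚ EqM B (Z ·ₘ D) →
                      Δ ⊢ₚ Mat.c Z ≼ Mat.a Z → Δ ⊢ₚ Mat.d Z ≼ Mat.b Z → Δ ⊢ₚ ⊥'
  rows-decreasing⇒⊥ {B = B} {mat z₁ z₂ z₃ z₄} {mat e f g h} dB H z₃≼z₁ z₄≼z₂ =
    Dom⇒row₂⋠row₁ {B = B} dB
      (≐≼≐ (∧E₁ (∧E₂ (∧E₂ H))) (⊕-mono-≼ (⊗-monoˡ-≼ e z₃≼z₁) (⊗-monoˡ-≼ g z₄≼z₂)) (≐sym (∧E₁ H)))
      (≐≼≐ (∧E₂ (∧E₂ (∧E₂ H))) (⊕-mono-≼ (⊗-monoˡ-≼ f z₃≼z₁) (⊗-monoˡ-≼ h z₄≼z₂)) (≐sym (∧E₁ (∧E₂ H))))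

  Shape-of-left-factor : ∀ {B Z D : Mat Γ} → Δ ⊢ₚ Det Z → Δ ⊢ₚ Dom B → Δ ⊢ₚ EqM B (Z ·ₘ D) → Δ ⊢ₚ Shape Z
  Shape-of-left-factor {Z = Z@(mat z₁ z₂ z₃ z₄)} detZ dB H = ∨E (≼∨> z₁ z₃)
    (∨I₂ (∧I (hyp hd) (a≼c⇒b≼d {Z = Z} (weaken₁ detZ) (hyp hd))))
    (∨E (≼∨> z₄ z₂)
      (⊥E (rows-decreasing⇒⊥ {Z = Z} (weaken₁ (weaken₁ dB)) (weaken₁ (weaken₁ H)) (<⇒≼ (hyp (tl hd))) (hyp hd)))
      (∨I₁ (c<a∧b<d⇒b≐𝟘∧c≐𝟘 {Z = Z} (weaken₁ (weaken₁ detZ)) (hyp (tl hd)) (hyp hd))))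

  editor-witness : ∀ {A B C D : Mat Γ} {z₁ z₂ z₃ z₄} →
                   Δ ⊢ₚ Dom A → Δ ⊢ₚ Dom B → Δ ⊢ₚ Dom C → Δ ⊢ₚ EqM (A ·ₘ B) (C ·ₘ D) →
                   Δ ⊢ₚ Mat.a C ⊗ Mat.d A ≐ Mat.c C ⊗ Mat.b A ⊕ z₁ → Δ ⊢ₚ Mat.b C ⊗ Mat.d A ≐ Mat.d C ⊗ Mat.b A ⊕ z₂ →
                   Δ ⊢ₚ Mat.a A ⊗ Mat.c C ≐ Mat.c A ⊗ Mat.a C ⊕ z₃ → Δ ⊢ₚ Mat.a A ⊗ Mat.d C ≐ Mat.c A ⊗ Mat.b C ⊕ z₄ →
                   Δ ⊢ₚ Dom (mat z₁ z₂ z₃ z₄) ∧' (EqM (A ·ₘ mat z₁ z₂ z₃ z₄) C ∧' EqM B (mat z₁ z₂ z₃ z₄ ·ₘ D))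
  editor-witness {A = A} {B} {C} {D} {z₁} {z₂} {z₃} {z₄} dA dB dC H e₁ e₂ e₃ e₄ =
    ∧I (∧I detZ (Shape-of-left-factor {Z = Z} detZ dB B≐ZD)) (∧I AZ≐C B≐ZD)
    where
    Z = mat z₁ z₂ z₃ z₄
    first = adjugate-column (∧E₁ dA) e₁ e₃
    second = adjugate-column (∧E₁ dA) e₂ e₄
    AZ≐C : _ ⊢ₚ EqM (A ·ₘ Z) C
    AZ≐C = ∧I (∧E₁ first) (∧I (∧E₁ second) (∧I (∧E₂ first) (∧E₂ second)))
    B≐ZD : _ ⊢ₚ EqM B (Z ·ₘ D)
    B≐ZD = ·ₘ-cancelˡ (∧E₁ dA) (EqM-trans H (EqM-trans (·ₘ-congʳ D (EqM-sym AZ≐C)) (·ₘ-assoc A Z D)))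
    detZ = det-cancelˡ {A = A} (∧E₁ dA) (det-resp-EqM AZ≐C (∧E₁ dC))

module TranslationProperties where

  open import Data.List using (List; _∷_)
  open import Data.Unit using (⊤; tt)
  open import Relation.Binary.PropositionalEquality using (_≡_; refl; sym; trans; cong; cong₂)
  open PAminusReasoning

  extend : FSort → List ⊤ → List ⊤
  extend 𝔬 Δ = tt ∷ Δ
  extend 𝔰 Δ = tt ∷ tt ∷ tt ∷ tt ∷ Δ

  skip : ∀ σ {Δ} → PA.Ren Δ (extend σ Δ)
  skip 𝔬 x = there x
  skip 𝔰 x = there (there (there (there x)))

  subTr : ∀ {σ Δ Δ'} → PA.Sub Δ Δ' → Tr σ Δ → Tr σ Δ'
  subTr {𝔬} s t             = subT s t
  subTr {𝔰} s (mat a b c d) = mat (subT s a) (subT s b) (subT s c) (subT s d)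

  liftSᵉ : ∀ σ {Δ Δ'} → PA.Sub Δ Δ' → PA.Sub (extend σ Δ) (extend σ Δ')
  liftSᵉ 𝔬 s = PA.liftS s
  liftSᵉ 𝔰 s = PA.liftS (PA.liftS (PA.liftS (PA.liftS s)))

  fresh : ∀ σ {Δ} → Tr σ (extend σ Δ)
  fresh 𝔬 = p0
  fresh 𝔰 = mat p3 p2 p1 p0

  inst : ∀ σ {Δ} → Tr σ Δ → PA.Sub (extend σ Δ) Δ
  inst 𝔬 t             = sub0 t
  inst 𝔰 (mat a b c d) = var ▹ a ▹ b ▹ c ▹ d

  mat-cong : ∀ {Δ} {a b c d a' b' c' d' : PTerm Δ} → a ≡ a' → b ≡ b' → c ≡ c' → d ≡ d' → mat a b c d ≡ mat a' b' c' d'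
  mat-cong refl refl refl refl = refl

  Env : List FSort → List ⊤ → Set
  Env Γ Δ = ∀ {σ} → Γ FU.∋ σ → Tr σ Δ

  infix 4 _≗ᵉ_

  _≗ᵉ_ : ∀ {Γ Δ} → Env Γ Δ → Env Γ Δ → Set
  _≗ᵉ_ {Γ} env env' = ∀ {σ} (x : Γ FU.∋ σ) → env x ≡ env' x

  liftEnv : ∀ {Γ Δ} σ → Env Γ Δ → Env (σ ∷ Γ) (extend σ Δ)
  liftEnv σ env FU.here      = fresh σ
  liftEnv σ env (FU.there x) = renTr (skip σ) (env x)

  trTermWith : ∀ {Γ Δ σ} → Env Γ Δ → FTerm Γ σ → Tr σ Δ
  trTermWith env (FU.var x)                                = env x
  trTermWith env (FU.app emp FU.nil)                       = mat 𝟙 𝟘 𝟘 𝟙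
  trTermWith env (FU.app atom (t FU.∷ₜ FU.nil))            = mat 𝟙 (trTermWith env t) 𝟙 (trTermWith env t ⊕ 𝟙)
  trTermWith env (FU.app star (t FU.∷ₜ u FU.∷ₜ FU.nil))    = trTermWith env t ·ₘ trTermWith env u
  trTermWith env (FU.app Fn (t FU.∷ₜ FU.nil))              = Fθ (trTermWith env t)

  allᵉ exᵉ : ∀ σ {Δ} → PFormula (extend σ Δ) → PFormula Δ
  allᵉ 𝔬 φ = ∀ₚ φ
  allᵉ 𝔰 φ = ∀ₚ (∀ₚ (∀ₚ (∀ₚ (Dom (mat p3 p2 p1 p0) ⇒ φ))))
  exᵉ 𝔬 φ = ∃ₚ φ
  exᵉ 𝔰 φ = ∃ₚ (∃ₚ (∃ₚ (∃ₚ (Dom (mat p3 p2 p1 p0) ∧' φ))))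

  θWith : ∀ {Γ Δ} → Env Γ Δ → FU.Formula Γ → PFormula Δ
  θWith env FU.⊥'              = ⊥'
  θWith env (FU._≐_ {𝔬} t u)   = trTermWith env t ≐ trTermWith env u
  θWith env (FU._≐_ {𝔰} t u)   = EqM (trTermWith env t) (trTermWith env u)
  θWith env (FU.rel () ts)
  θWith env (φ FU.⇒ ψ)         = θWith env φ ⇒ θWith env ψ
  θWith env (φ FU.∧' ψ)        = θWith env φ ∧' θWith env ψ
  θWith env (φ FU.∨' ψ)        = θWith env φ ∨' θWith env ψ
  θWith env (FU.all σ φ)       = allᵉ σ (θWith (liftEnv σ env) φ)
  θWith env (FU.ex σ φ)        = exᵉ σ (θWith (liftEnv σ env) φ)

  liftEnv-cong : ∀ {Γ Δ} σ {env env' : Env Γ Δ} → env ≗ᵉ env' → liftEnv σ env ≗ᵉ liftEnv σ env'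
  liftEnv-cong σ e FU.here      = refl
  liftEnv-cong σ e (FU.there x) = cong (renTr (skip σ)) (e x)

  trTermWith-cong : ∀ {Γ Δ σ} {env env' : Env Γ Δ} → env ≗ᵉ env' → (t : FTerm Γ σ) → trTermWith env t ≡ trTermWith env' t
  trTermWith-cong e (FU.var x)                             = e x
  trTermWith-cong e (FU.app emp FU.nil)                    = refl
  trTermWith-cong e (FU.app atom (t FU.∷ₜ FU.nil))         = cong (λ z → mat 𝟙 z 𝟙 (z ⊕ 𝟙)) (trTermWith-cong e t)
  trTermWith-cong e (FU.app star (t FU.∷ₜ u FU.∷ₜ FU.nil)) = cong₂ _·ₘ_ (trTermWith-cong e t) (trTermWith-cong e u)
  trTermWith-cong e (FU.app Fn (t FU.∷ₜ FU.nil))           = cong Fθ (trTermWith-cong e t)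

  θWith-cong : ∀ {Γ Δ} {env env' : Env Γ Δ} → env ≗ᵉ env' → (φ : FU.Formula Γ) → θWith env φ ≡ θWith env' φ
  θWith-cong e FU.⊥'            = refl
  θWith-cong e (FU._≐_ {𝔬} t u) = cong₂ _≐_ (trTermWith-cong e t) (trTermWith-cong e u)
  θWith-cong e (FU._≐_ {𝔰} t u) = cong₂ EqM (trTermWith-cong e t) (trTermWith-cong e u)
  θWith-cong e (FU.rel () ts)
  θWith-cong e (φ FU.⇒ ψ)       = cong₂ _⇒_ (θWith-cong e φ) (θWith-cong e ψ)
  θWith-cong e (φ FU.∧' ψ)      = cong₂ _∧'_ (θWith-cong e φ) (θWith-cong e ψ)
  θWith-cong e (φ FU.∨' ψ)      = cong₂ _∨'_ (θWith-cong e φ) (θWith-cong e ψ)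
  θWith-cong e (FU.all σ φ)     = cong (allᵉ σ) (θWith-cong (liftEnv-cong σ e) φ)
  θWith-cong e (FU.ex σ φ)      = cong (exᵉ σ) (θWith-cong (liftEnv-cong σ e) φ)

  trTerm≡trTermWith : ∀ {Γ σ} (t : FTerm Γ σ) → trTerm t ≡ trTermWith trVar t
  trTerm≡trTermWith (FU.var x)                             = refl
  trTerm≡trTermWith (FU.app emp FU.nil)                    = refl
  trTerm≡trTermWith (FU.app atom (t FU.∷ₜ FU.nil))         = cong (λ z → mat 𝟙 z 𝟙 (z ⊕ 𝟙)) (trTerm≡trTermWith t)
  trTerm≡trTermWith (FU.app star (t FU.∷ₜ u FU.∷ₜ FU.nil)) = cong₂ _·ₘ_ (trTerm≡trTermWith t) (trTerm≡trTermWith u)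
  trTerm≡trTermWith (FU.app Fn (t FU.∷ₜ FU.nil))           = cong Fθ (trTerm≡trTermWith t)

  trVar≗liftEnv-𝔬 : ∀ {Γ} → trVar {𝔬 ∷ Γ} ≗ᵉ liftEnv 𝔬 trVar
  trVar≗liftEnv-𝔬 FU.here      = refl
  trVar≗liftEnv-𝔬 (FU.there x) = refl

  trVar≗liftEnv-𝔰 : ∀ {Γ} → trVar {𝔰 ∷ Γ} ≗ᵉ liftEnv 𝔰 trVar
  trVar≗liftEnv-𝔰 FU.here      = refl
  trVar≗liftEnv-𝔰 (FU.there x) = refl

  θ≡θWith : ∀ {Γ} (φ : FU.Formula Γ) → θ φ ≡ θWith trVar φ
  θ≡θWith FU.⊥'            = refl
  θ≡θWith (FU._≐_ {𝔬} t u) = cong₂ _≐_ (trTerm≡trTermWith t) (trTerm≡trTermWith u)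
  θ≡θWith (FU._≐_ {𝔰} t u) = cong₂ EqM (trTerm≡trTermWith t) (trTerm≡trTermWith u)
  θ≡θWith (FU.rel () ts)
  θ≡θWith (φ FU.⇒ ψ)       = cong₂ _⇒_ (θ≡θWith φ) (θ≡θWith ψ)
  θ≡θWith (φ FU.∧' ψ)      = cong₂ _∧'_ (θ≡θWith φ) (θ≡θWith ψ)
  θ≡θWith (φ FU.∨' ψ)      = cong₂ _∨'_ (θ≡θWith φ) (θ≡θWith ψ)
  θ≡θWith (FU.all 𝔬 φ)     = cong (allᵉ 𝔬) (trans (θ≡θWith φ) (θWith-cong trVar≗liftEnv-𝔬 φ))
  θ≡θWith (FU.all 𝔰 φ)     = cong (allᵉ 𝔰) (trans (θ≡θWith φ) (θWith-cong trVar≗liftEnv-𝔰 φ))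
  θ≡θWith (FU.ex 𝔬 φ)      = cong (exᵉ 𝔬) (trans (θ≡θWith φ) (θWith-cong trVar≗liftEnv-𝔬 φ))
  θ≡θWith (FU.ex 𝔰 φ)      = cong (exᵉ 𝔰) (trans (θ≡θWith φ) (θWith-cong trVar≗liftEnv-𝔰 φ))

  trTermWith-renT : ∀ {Γ Γ' Δ σ} (env : Env Γ' Δ) (ρ : FU.Ren Γ Γ') (t : FTerm Γ σ) →
                    trTermWith env (FU.renT ρ t) ≡ trTermWith (λ x → env (ρ x)) t
  trTermWith-renT env ρ (FU.var x)                             = refl
  trTermWith-renT env ρ (FU.app emp FU.nil)                    = refl
  trTermWith-renT env ρ (FU.app atom (t FU.∷ₜ FU.nil))         = cong (λ z → mat 𝟙 z 𝟙 (z ⊕ 𝟙)) (trTermWith-renT env ρ t)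
  trTermWith-renT env ρ (FU.app star (t FU.∷ₜ u FU.∷ₜ FU.nil)) =
    cong₂ _·ₘ_ (trTermWith-renT env ρ t) (trTermWith-renT env ρ u)
  trTermWith-renT env ρ (FU.app Fn (t FU.∷ₜ FU.nil))           = cong Fθ (trTermWith-renT env ρ t)

  liftEnv-liftR : ∀ {Γ Γ' Δ} σ (env : Env Γ' Δ) (ρ : FU.Ren Γ Γ') →
                  (λ {τ} (x : (σ ∷ Γ) FU.∋ τ) → liftEnv σ env (FU.liftR ρ x)) ≗ᵉ liftEnv σ (λ x → env (ρ x))
  liftEnv-liftR σ env ρ FU.here      = refl
  liftEnv-liftR σ env ρ (FU.there x) = refl

  θWith-renF : ∀ {Γ Γ' Δ} (env : Env Γ' Δ) (ρ : FU.Ren Γ Γ') (φ : FU.Formula Γ) →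
               θWith env (FU.renF ρ φ) ≡ θWith (λ x → env (ρ x)) φ
  θWith-renF env ρ FU.⊥'            = refl
  θWith-renF env ρ (FU._≐_ {𝔬} t u) = cong₂ _≐_ (trTermWith-renT env ρ t) (trTermWith-renT env ρ u)
  θWith-renF env ρ (FU._≐_ {𝔰} t u) = cong₂ EqM (trTermWith-renT env ρ t) (trTermWith-renT env ρ u)
  θWith-renF env ρ (FU.rel () ts)
  θWith-renF env ρ (φ FU.⇒ ψ)       = cong₂ _⇒_ (θWith-renF env ρ φ) (θWith-renF env ρ ψ)
  θWith-renF env ρ (φ FU.∧' ψ)      = cong₂ _∧'_ (θWith-renF env ρ φ) (θWith-renF env ρ ψ)
  θWith-renF env ρ (φ FU.∨' ψ)      = cong₂ _∨'_ (θWith-renF env ρ φ) (θWith-renF env ρ ψ)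
  θWith-renF env ρ (FU.all σ φ)     =
    cong (allᵉ σ) (trans (θWith-renF (liftEnv σ env) (FU.liftR ρ) φ) (θWith-cong (liftEnv-liftR σ env ρ) φ))
  θWith-renF env ρ (FU.ex σ φ)      =
    cong (exᵉ σ) (trans (θWith-renF (liftEnv σ env) (FU.liftR ρ) φ) (θWith-cong (liftEnv-liftR σ env ρ) φ))

  trTermWith-subTr : ∀ {Γ Δ Δ' σ} (s : PA.Sub Δ Δ') (env : Env Γ Δ) (t : FTerm Γ σ) →
                     trTermWith (λ x → subTr s (env x)) t ≡ subTr s (trTermWith env t)
  trTermWith-subTr s env (FU.var x)                             = refl
  trTermWith-subTr s env (FU.app emp FU.nil)                    = refl
  trTermWith-subTr s env (FU.app atom (t FU.∷ₜ FU.nil))         = cong (λ z → mat 𝟙 z 𝟙 (z ⊕ 𝟙)) (trTermWith-subTr s env t)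
  trTermWith-subTr s env (FU.app star (t FU.∷ₜ u FU.∷ₜ FU.nil)) =
    cong₂ _·ₘ_ (trTermWith-subTr s env t) (trTermWith-subTr s env u)
  trTermWith-subTr s env (FU.app Fn (t FU.∷ₜ FU.nil))           = cong Fθ (trTermWith-subTr s env t)

  trTermWith-renTr : ∀ {Γ Δ Δ' σ} (ρ : PA.Ren Δ Δ') (env : Env Γ Δ) (t : FTerm Γ σ) →
                     trTermWith (λ x → renTr ρ (env x)) t ≡ renTr ρ (trTermWith env t)
  trTermWith-renTr ρ env (FU.var x)                             = refl
  trTermWith-renTr ρ env (FU.app emp FU.nil)                    = refl
  trTermWith-renTr ρ env (FU.app atom (t FU.∷ₜ FU.nil))         = cong (λ z → mat 𝟙 z 𝟙 (z ⊕ 𝟙)) (trTermWith-renTr ρ env t)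
  trTermWith-renTr ρ env (FU.app star (t FU.∷ₜ u FU.∷ₜ FU.nil)) =
    cong₂ _·ₘ_ (trTermWith-renTr ρ env t) (trTermWith-renTr ρ env u)
  trTermWith-renTr ρ env (FU.app Fn (t FU.∷ₜ FU.nil))           = cong Fθ (trTermWith-renTr ρ env t)

  liftSᵉ-skip : ∀ σ {Δ Δ'} (s : PA.Sub Δ Δ') {τ} (x : Δ PA.∋ τ) → liftSᵉ σ s (skip σ x) ≡ renT (skip σ) (s x)
  liftSᵉ-skip 𝔬 s x = refl
  liftSᵉ-skip 𝔰 s x = trans (renT-renT there _ _) (trans (renT-renT _ there _) (renT-renT _ there (s x)))

  renT-skip-subT : ∀ σ {Δ Δ'} (s : PA.Sub Δ Δ') (t : PTerm Δ) →
                   renT (skip σ) (subT s t) ≡ subT (liftSᵉ σ s) (renT (skip σ) t)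
  renT-skip-subT σ s t =
    trans (renT-subT (skip σ) s t)
          (trans (subT-cong (λ x → sym (liftSᵉ-skip σ s x)) t) (sym (subT-renT (liftSᵉ σ s) (skip σ) t)))

  renTr-skip-subTr : ∀ σ {τ Δ Δ'} (s : PA.Sub Δ Δ') (m : Tr τ Δ) →
                     renTr (skip σ) (subTr s m) ≡ subTr (liftSᵉ σ s) (renTr (skip σ) m)
  renTr-skip-subTr σ {𝔬} s t             = renT-skip-subT σ s t
  renTr-skip-subTr σ {𝔰} s (mat a b c d) =
    mat-cong (renT-skip-subT σ s a) (renT-skip-subT σ s b) (renT-skip-subT σ s c) (renT-skip-subT σ s d)

  liftEnv-subTr : ∀ {Γ Δ Δ'} σ (s : PA.Sub Δ Δ') (env : Env Γ Δ) →
                  liftEnv σ (λ x → subTr s (env x)) ≗ᵉ (λ x → subTr (liftSᵉ σ s) (liftEnv σ env x))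
  liftEnv-subTr 𝔬 s env FU.here      = refl
  liftEnv-subTr 𝔰 s env FU.here      = refl
  liftEnv-subTr σ s env (FU.there x) = renTr-skip-subTr σ s (env x)

  subF-allᵉ : ∀ σ {Δ Δ'} (s : PA.Sub Δ Δ') (φ : PFormula (extend σ Δ)) → subF s (allᵉ σ φ) ≡ allᵉ σ (subF (liftSᵉ σ s) φ)
  subF-allᵉ 𝔬 s φ = refl
  subF-allᵉ 𝔰 s φ = refl

  subF-exᵉ : ∀ σ {Δ Δ'} (s : PA.Sub Δ Δ') (φ : PFormula (extend σ Δ)) → subF s (exᵉ σ φ) ≡ exᵉ σ (subF (liftSᵉ σ s) φ)
  subF-exᵉ 𝔬 s φ = refl
  subF-exᵉ 𝔰 s φ = refl

  θWith-subTr : ∀ {Γ Δ Δ'} (s : PA.Sub Δ Δ') (env : Env Γ Δ) (φ : FU.Formula Γ) →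
                θWith (λ x → subTr s (env x)) φ ≡ subF s (θWith env φ)
  θWith-subTr s env FU.⊥'            = refl
  θWith-subTr s env (FU._≐_ {𝔬} t u) = cong₂ _≐_ (trTermWith-subTr s env t) (trTermWith-subTr s env u)
  θWith-subTr s env (FU._≐_ {𝔰} t u) = cong₂ EqM (trTermWith-subTr s env t) (trTermWith-subTr s env u)
  θWith-subTr s env (FU.rel () ts)
  θWith-subTr s env (φ FU.⇒ ψ)       = cong₂ _⇒_ (θWith-subTr s env φ) (θWith-subTr s env ψ)
  θWith-subTr s env (φ FU.∧' ψ)      = cong₂ _∧'_ (θWith-subTr s env φ) (θWith-subTr s env ψ)
  θWith-subTr s env (φ FU.∨' ψ)      = cong₂ _∨'_ (θWith-subTr s env φ) (θWith-subTr s env ψ)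
  θWith-subTr s env (FU.all σ φ)     =
    trans (cong (allᵉ σ) (trans (θWith-cong (liftEnv-subTr σ s env) φ) (θWith-subTr (liftSᵉ σ s) (liftEnv σ env) φ)))
          (sym (subF-allᵉ σ s _))
  θWith-subTr s env (FU.ex σ φ)      =
    trans (cong (exᵉ σ) (trans (θWith-cong (liftEnv-subTr σ s env) φ) (θWith-subTr (liftSᵉ σ s) (liftEnv σ env) φ)))
          (sym (subF-exᵉ σ s _))

  renTr≡subTr : ∀ {σ Δ Δ'} (ρ : PA.Ren Δ Δ') (m : Tr σ Δ) → renTr ρ m ≡ subTr (λ x → var (ρ x)) m
  renTr≡subTr {𝔬} ρ t             = sym (trans (sym (subT-renT var ρ t)) (subT-id (renT ρ t)))
  renTr≡subTr {𝔰} ρ (mat a b c d) =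
    mat-cong (renTr≡subTr {𝔬} ρ a) (renTr≡subTr {𝔬} ρ b) (renTr≡subTr {𝔬} ρ c) (renTr≡subTr {𝔬} ρ d)

  renF≡subF : ∀ {Δ Δ'} (ρ : PA.Ren Δ Δ') (φ : PFormula Δ) → renF ρ φ ≡ subF (λ x → var (ρ x)) φ
  renF≡subF ρ φ = sym (trans (sym (subF-renF var ρ φ)) (subF-id (renF ρ φ)))

  θWith-renTr : ∀ {Γ Δ Δ'} (ρ : PA.Ren Δ Δ') (env : Env Γ Δ) (φ : FU.Formula Γ) →
                θWith (λ x → renTr ρ (env x)) φ ≡ renF ρ (θWith env φ)
  θWith-renTr ρ env φ =
    trans (θWith-cong (λ x → renTr≡subTr ρ (env x)) φ)
          (trans (θWith-subTr (λ x → var (ρ x)) env φ) (sym (renF≡subF ρ (θWith env φ))))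

  θWith-wkF : ∀ {Γ Δ σ} (env : Env (σ ∷ Γ) Δ) (ρ : PA.Ren ⟦ Γ ⟧ Δ) →
              (∀ {τ} (x : Γ FU.∋ τ) → env (FU.there x) ≡ renTr ρ (trVar x)) →
              (ψ : FU.Formula Γ) → θWith env (FU.wkF ψ) ≡ renF ρ (θ ψ)
  θWith-wkF env ρ e ψ =
    trans (θWith-renF env FU.there ψ)
      (trans (θWith-cong e ψ) (trans (θWith-renTr ρ trVar ψ) (cong (renF ρ) (sym (θ≡θWith ψ)))))

  θ-wkF-𝔬 : ∀ {Γ} (ψ : FU.Formula Γ) → θ (FU.wkF {τ = 𝔬} ψ) ≡ renF (skip 𝔬) (θ ψ)
  θ-wkF-𝔬 ψ = trans (θ≡θWith (FU.wkF ψ)) (θWith-wkF trVar (skip 𝔬) (λ x → refl) ψ)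

  θ-wkF-𝔰 : ∀ {Γ} (ψ : FU.Formula Γ) → θ (FU.wkF {τ = 𝔰} ψ) ≡ renF (skip 𝔰) (θ ψ)
  θ-wkF-𝔰 ψ = trans (θ≡θWith (FU.wkF ψ)) (θWith-wkF trVar (skip 𝔰) (λ x → refl) ψ)

  θ-closeF : ∀ {Γ} (φ : FU.Sentence) → θ {Γ} (FU.closeF φ) ≡ PA.closeF (θ φ)
  θ-closeF φ =
    trans (θ≡θWith (FU.closeF φ))
      (trans (θWith-renF trVar (λ ()) φ)
        (trans (θWith-cong (λ ()) φ)
          (trans (θWith-renTr (λ ()) trVar φ)
            (trans (cong (renF (λ ())) (sym (θ≡θWith φ))) (renF-cong (λ ()) (θ φ))))))

  trTermWith-subT : ∀ {Γ Γ' Δ σ} (env : Env Γ' Δ) (s : FU.Sub Γ Γ') (t : FTerm Γ σ) →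
                    trTermWith env (FU.subT s t) ≡ trTermWith (λ x → trTermWith env (s x)) t
  trTermWith-subT env s (FU.var x)                             = refl
  trTermWith-subT env s (FU.app emp FU.nil)                    = refl
  trTermWith-subT env s (FU.app atom (t FU.∷ₜ FU.nil))         = cong (λ z → mat 𝟙 z 𝟙 (z ⊕ 𝟙)) (trTermWith-subT env s t)
  trTermWith-subT env s (FU.app star (t FU.∷ₜ u FU.∷ₜ FU.nil)) =
    cong₂ _·ₘ_ (trTermWith-subT env s t) (trTermWith-subT env s u)
  trTermWith-subT env s (FU.app Fn (t FU.∷ₜ FU.nil))           = cong Fθ (trTermWith-subT env s t)

  liftEnv-liftS : ∀ {Γ Γ' Δ} σ (env : Env Γ' Δ) (s : FU.Sub Γ Γ') →
                  (λ {τ} (x : (σ ∷ Γ) FU.∋ τ) → trTermWith (liftEnv σ env) (FU.liftS s x))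
                    ≗ᵉ liftEnv σ (λ x → trTermWith env (s x))
  liftEnv-liftS σ env s FU.here      = refl
  liftEnv-liftS σ env s (FU.there x) =
    trans (trTermWith-renT (liftEnv σ env) FU.there (s x)) (trTermWith-renTr (skip σ) env (s x))

  θWith-subF : ∀ {Γ Γ' Δ} (env : Env Γ' Δ) (s : FU.Sub Γ Γ') (φ : FU.Formula Γ) →
               θWith env (FU.subF s φ) ≡ θWith (λ x → trTermWith env (s x)) φ
  θWith-subF env s FU.⊥'            = refl
  θWith-subF env s (FU._≐_ {𝔬} t u) = cong₂ _≐_ (trTermWith-subT env s t) (trTermWith-subT env s u)
  θWith-subF env s (FU._≐_ {𝔰} t u) = cong₂ EqM (trTermWith-subT env s t) (trTermWith-subT env s u)
  θWith-subF env s (FU.rel () ts)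
  θWith-subF env s (φ FU.⇒ ψ)       = cong₂ _⇒_ (θWith-subF env s φ) (θWith-subF env s ψ)
  θWith-subF env s (φ FU.∧' ψ)      = cong₂ _∧'_ (θWith-subF env s φ) (θWith-subF env s ψ)
  θWith-subF env s (φ FU.∨' ψ)      = cong₂ _∨'_ (θWith-subF env s φ) (θWith-subF env s ψ)
  θWith-subF env s (FU.all σ φ)     =
    cong (allᵉ σ) (trans (θWith-subF (liftEnv σ env) (FU.liftS s) φ) (θWith-cong (liftEnv-liftS σ env s) φ))
  θWith-subF env s (FU.ex σ φ)      =
    cong (exᵉ σ) (trans (θWith-subF (liftEnv σ env) (FU.liftS s) φ) (θWith-cong (liftEnv-liftS σ env s) φ))

  inst-skip : ∀ σ {Δ} (m : Tr σ Δ) (t : PTerm Δ) → subT (inst σ m) (renT (skip σ) t) ≡ t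
  inst-skip σ m t = trans (subT-renT (inst σ m) (skip σ) t) (trans (subT-cong (pointwise σ m) t) (subT-id t))
    where
    pointwise : ∀ σ {Δ} (m : Tr σ Δ) → (λ {τ} (x : Δ PA.∋ τ) → inst σ m (skip σ x)) ≗ₛ var
    pointwise 𝔬 m x = refl
    pointwise 𝔰 m x = refl

  inst-skipTr : ∀ σ {τ Δ} (m : Tr σ Δ) (n : Tr τ Δ) → subTr (inst σ m) (renTr (skip σ) n) ≡ n
  inst-skipTr σ {𝔬} m t             = inst-skip σ m t
  inst-skipTr σ {𝔰} m (mat a b c d) = mat-cong (inst-skip σ m a) (inst-skip σ m b) (inst-skip σ m c) (inst-skip σ m d)

  θ-sub0-with : ∀ {Γ Δ σ} (t : FTerm Γ σ) (φ : FU.Formula (σ ∷ Γ)) (s : PA.Sub Δ ⟦ Γ ⟧) (env : Env (σ ∷ Γ) Δ) →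
                (∀ {τ} (x : (σ ∷ Γ) FU.∋ τ) → trTermWith trVar (FU.sub0 t x) ≡ subTr s (env x)) →
                θ (φ FU.[ t ]) ≡ subF s (θWith env φ)
  θ-sub0-with t φ s env e =
    trans (θ≡θWith _) (trans (θWith-subF trVar (FU.sub0 t) φ) (trans (θWith-cong e φ) (θWith-subTr s env φ)))

  θ-sub0-𝔬 : ∀ {Γ} (t : FTerm Γ 𝔬) (φ : FU.Formula (𝔬 ∷ Γ)) → θ (φ FU.[ t ]) ≡ subF (inst 𝔬 (trTerm t)) (θ φ)
  θ-sub0-𝔬 t φ = trans (θ-sub0-with t φ (inst 𝔬 (trTerm t)) trVar pointwise) (cong (subF _) (sym (θ≡θWith φ)))
    where
    pointwise : ∀ {τ} (x : _ FU.∋ τ) → _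
    pointwise FU.here      = sym (trTerm≡trTermWith t)
    pointwise (FU.there x) = sym (inst-skipTr 𝔬 (trTerm t) (trVar x))

  θ-sub0-𝔰 : ∀ {Γ} (t : FTerm Γ 𝔰) (φ : FU.Formula (𝔰 ∷ Γ)) → θ (φ FU.[ t ]) ≡ subF (inst 𝔰 (trTerm t)) (θ φ)
  θ-sub0-𝔰 t φ = trans (θ-sub0-with t φ (inst 𝔰 (trTerm t)) trVar pointwise) (cong (subF _) (sym (θ≡θWith φ)))
    where
    pointwise : ∀ {τ} (x : _ FU.∋ τ) → _
    pointwise FU.here      = sym (trTerm≡trTermWith t)
    pointwise (FU.there x) = sym (inst-skipTr 𝔰 (trTerm t) (trVar x))

module MatrixRewriting where

  open import Data.List using (List; _∷_)
  open import Data.Unit using (tt)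
  open import Relation.Binary.PropositionalEquality using (_≡_; refl; sym; trans; subst)
  open PAminusReasoning

  private
    slots : ∀ {Γ} (x₁ x₂ x₃ x₄ : PTerm (tt ∷ Γ)) → PA.Sub (tt ∷ tt ∷ tt ∷ tt ∷ Γ) (tt ∷ Γ)
    slots x₁ x₂ x₃ x₄ = (λ y → var (there y)) ▹ x₁ ▹ x₂ ▹ x₃ ▹ x₄

    sub0-slots : ∀ {Γ} (v : PTerm Γ) (x₁ x₂ x₃ x₄ : PTerm (tt ∷ Γ)) {y₁ y₂ y₃ y₄ : PTerm Γ} →
                 subT (sub0 v) x₁ ≡ y₁ → subT (sub0 v) x₂ ≡ y₂ → subT (sub0 v) x₃ ≡ y₃ → subT (sub0 v) x₄ ≡ y₄ →
                 (λ {σ} y → subT (sub0 v) (slots x₁ x₂ x₃ x₄ {σ} y)) ≗ₛ var ▹ y₁ ▹ y₂ ▹ y₃ ▹ y₄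
    sub0-slots v x₁ x₂ x₃ x₄ e₁ e₂ e₃ e₄ here                                = e₄
    sub0-slots v x₁ x₂ x₃ x₄ e₁ e₂ e₃ e₄ (there here)                        = e₃
    sub0-slots v x₁ x₂ x₃ x₄ e₁ e₂ e₃ e₄ (there (there here))                = e₂
    sub0-slots v x₁ x₂ x₃ x₄ e₁ e₂ e₃ e₄ (there (there (there here)))        = e₁
    sub0-slots v x₁ x₂ x₃ x₄ e₁ e₂ e₃ e₄ (there (there (there (there y))))   = refl

    ≐subst-through : ∀ {Θ Γ} {Δ : List (PFormula Γ)} (χ : PFormula Θ) (s★ : PA.Sub Θ (tt ∷ Γ))
                       {s s' : PA.Sub Θ Γ} {t u : PTerm Γ} →
                     (λ {σ} y → subT (sub0 t) (s★ {σ} y)) ≗ₛ s → (λ {σ} y → subT (sub0 u) (s★ {σ} y)) ≗ₛ s' →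
                     Δ ⊢ₚ t ≐ u → Δ ⊢ₚ subF s χ → Δ ⊢ₚ subF s' χ
    ≐subst-through {Δ = Δ} χ s★ {t = t} {u} e e' t≐u d =
      subst (Δ ⊢ₚ_) (trans (subF-subF (sub0 u) s★ χ) (subF-cong e' χ))
        (≐subst (subF s★ χ) t≐u (subst (Δ ⊢ₚ_) (sym (trans (subF-subF (sub0 t) s★ χ) (subF-cong e χ))) d))

  ≐subst-mat : ∀ {Γ} {Δ : List (PFormula Γ)} (χ : PFormula (tt ∷ tt ∷ tt ∷ tt ∷ Γ)) {a b c d a' b' c' d' : PTerm Γ} →
               Δ ⊢ₚ EqM (mat a b c d) (mat a' b' c' d') →
               Δ ⊢ₚ subF (var ▹ a ▹ b ▹ c ▹ d) χ → Δ ⊢ₚ subF (var ▹ a' ▹ b' ▹ c' ▹ d') χ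
  ≐subst-mat χ {a} {b} {c} {d} {a'} {b'} {c'} {d'} H p =
    ≐subst-through χ (slots (w a') (w b') (w c') p0)
      (sub0-slots _ _ _ _ _ (sub0-wk d a') (sub0-wk d b') (sub0-wk d c') refl)
      (sub0-slots _ _ _ _ _ (sub0-wk d' a') (sub0-wk d' b') (sub0-wk d' c') refl) (∧E₂ (∧E₂ (∧E₂ H)))
    (≐subst-through χ (slots (w a') (w b') p0 (w d))
      (sub0-slots _ _ _ _ _ (sub0-wk c a') (sub0-wk c b') refl (sub0-wk c d))
      (sub0-slots _ _ _ _ _ (sub0-wk c' a') (sub0-wk c' b') refl (sub0-wk c' d)) (∧E₁ (∧E₂ (∧E₂ H)))
    (≐subst-through χ (slots (w a') p0 (w c) (w d))
      (sub0-slots _ _ _ _ _ (sub0-wk b a') refl (sub0-wk b c) (sub0-wk b d))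
      (sub0-slots _ _ _ _ _ (sub0-wk b' a') refl (sub0-wk b' c) (sub0-wk b' d)) (∧E₁ (∧E₂ H))
    (≐subst-through χ (slots p0 (w b) (w c) (w d))
      (sub0-slots _ _ _ _ _ refl (sub0-wk a b) (sub0-wk a c) (sub0-wk a d))
      (sub0-slots _ _ _ _ _ refl (sub0-wk a' b) (sub0-wk a' c) (sub0-wk a' d)) (∧E₁ H) p)))
    where
    w : ∀ {Γ} → PTerm Γ → PTerm (tt ∷ Γ)
    w = renT there

module EditorsAxiom where

  open import Data.List using (List; _∷_)
  open import Data.Unit using (⊤; tt)
  open import Relation.Binary.PropositionalEquality using (_≡_; refl; sym; trans; cong; subst)
  open PAminusReasoning
  open PAminusOrder using (subtraction)
  open Matrices using (EqM-sym)
  open Cones using (cone_⊆cone_; cones-nest)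
  open EditorWitness using (editor-witness)
  open TranslationProperties using (skip; subTr; fresh; inst; inst-skipTr)

  private variable
    Γ : List ⊤
    Δ : List (PFormula Γ)

  W⁴ : PTerm Γ → PTerm (tt ∷ tt ∷ tt ∷ tt ∷ Γ)
  W⁴ t = renT there (renT there (renT there (renT there t)))

  W⁴ᵐ : Mat Γ → Mat (tt ∷ tt ∷ tt ∷ tt ∷ Γ)
  W⁴ᵐ m = renTr there (renTr there (renTr there (renTr there m)))

  -- Opaque so that the goals mentioning it stay small.
  opaque
    EditorBody : Mat Γ → Mat Γ → Mat Γ → Mat Γ → Mat Γ → PFormula Γ
    EditorBody E A B C D = Dom E ∧' ((EqM (A ·ₘ E) C ∧' EqM B (E ·ₘ D)) ∨' (EqM A (C ·ₘ E) ∧' EqM (E ·ₘ B) D))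

  opaque
    unfolding EditorBody

    renF-EditorBody : ∀ {Γ'} (ρ : PA.Ren Γ Γ') (E A B C D : Mat Γ) →
                      renF ρ (EditorBody E A B C D) ≡ EditorBody (renTr ρ E) (renTr ρ A) (renTr ρ B) (renTr ρ C) (renTr ρ D)
    renF-EditorBody ρ E A B C D = refl

    subF-EditorBody : ∀ {Γ'} (s : PA.Sub Γ Γ') (E A B C D : Mat Γ) →
                      subF s (EditorBody E A B C D) ≡ EditorBody (subTr s E) (subTr s A) (subTr s B) (subTr s C) (subTr s D)
    subF-EditorBody s E A B C D = refl

    EditorBody-left : ∀ {E A B C D : Mat Γ} → Δ ⊢ₚ Dom E ∧' (EqM (A ·ₘ E) C ∧' EqM B (E ·ₘ D)) → Δ ⊢ₚ EditorBody E A B C D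
    EditorBody-left w = ∧I (∧E₁ w) (∨I₁ (∧E₂ w))

    EditorBody-right : ∀ {E A B C D : Mat Γ} → Δ ⊢ₚ Dom E ∧' (EqM (C ·ₘ E) A ∧' EqM D (E ·ₘ B)) → Δ ⊢ₚ EditorBody E A B C D
    EditorBody-right w = ∧I (∧E₁ w) (∨I₂ (∧I (EqM-sym (∧E₁ (∧E₂ w))) (EqM-sym (∧E₂ (∧E₂ w)))))

  EditorGoal : Mat Γ → Mat Γ → Mat Γ → Mat Γ → PFormula Γ
  EditorGoal A B C D = ∃ₚ (∃ₚ (∃ₚ (∃ₚ (EditorBody (fresh 𝔰) (↑ A) (↑ B) (↑ C) (↑ D)))))
    where
    ↑ : Mat _ → Mat _
    ↑ = renTr (skip 𝔰)

  private
    cong₄ : ∀ {A B : Set} (f : A → A → A → A → B) {x₁ x₂ x₃ x₄ y₁ y₂ y₃ y₄ : A} →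
            x₁ ≡ y₁ → x₂ ≡ y₂ → x₃ ≡ y₃ → x₄ ≡ y₄ → f x₁ x₂ x₃ x₄ ≡ f y₁ y₂ y₃ y₄
    cong₄ f refl refl refl refl = refl

    liftR⁴-skip : ∀ (m : Mat Γ) →
                  renTr (PA.liftR (PA.liftR (PA.liftR (PA.liftR there)))) (renTr (skip 𝔰) m) ≡ renTr (skip 𝔰) (renTr there m)
    liftR⁴-skip (mat a b c d) = TranslationProperties.mat-cong (swap a) (swap b) (swap c) (swap d)
      where
      swap : ∀ t → _
      swap t = trans (renT-renT _ (skip 𝔰) t) (sym (renT-renT (skip 𝔰) there t))

  EditorGoal-wkF : ∀ (A B C D : Mat Γ) →
                   wkF (EditorGoal A B C D) ≡ EditorGoal (renTr there A) (renTr there B) (renTr there C) (renTr there D)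
  EditorGoal-wkF A B C D =
    cong (λ φ → ∃ₚ (∃ₚ (∃ₚ (∃ₚ φ))))
      (trans (renF-EditorBody _ (fresh 𝔰) (↑ A) (↑ B) (↑ C) (↑ D))
             (cong₄ (EditorBody (fresh 𝔰)) (liftR⁴-skip A) (liftR⁴-skip B) (liftR⁴-skip C) (liftR⁴-skip D)))
    where
    ↑ : Mat _ → Mat _
    ↑ = renTr (skip 𝔰)

  EditorGoal-wkF⁴ : ∀ (A B C D : Mat Γ) →
                    wkF (wkF (wkF (wkF (EditorGoal A B C D)))) ≡ EditorGoal (W⁴ᵐ A) (W⁴ᵐ B) (W⁴ᵐ C) (W⁴ᵐ D)
  EditorGoal-wkF⁴ A B C D =
    trans (cong (λ φ → wkF (wkF (wkF φ))) (EditorGoal-wkF A B C D))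
      (trans (cong (λ φ → wkF (wkF φ)) (EditorGoal-wkF _ _ _ _))
        (trans (cong wkF (EditorGoal-wkF _ _ _ _)) (EditorGoal-wkF _ _ _ _)))

  EditorGoal-intro : ∀ {A B C D : Mat Γ} z₁ z₂ z₃ z₄ → Δ ⊢ₚ EditorBody (mat z₁ z₂ z₃ z₄) A B C D → Δ ⊢ₚ EditorGoal A B C D
  EditorGoal-intro {Δ = Δ} {A} {B} {C} {D} z₁ z₂ z₃ z₄ d =
    ∃I₄ z₁ z₂ z₃ z₄ (subst (Δ ⊢ₚ_) (sym body≡) d)
    where
    Z = mat z₁ z₂ z₃ z₄
    ↑ : Mat _ → Mat _
    ↑ = renTr (skip 𝔰)
    body≡ = trans (subF-EditorBody (inst 𝔰 Z) (fresh 𝔰) (↑ A) (↑ B) (↑ C) (↑ D))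
                  (cong₄ (EditorBody Z) (inst-skipTr 𝔰 Z A) (inst-skipTr 𝔰 Z B) (inst-skipTr 𝔰 Z C) (inst-skipTr 𝔰 Z D))

  subtraction₄ : ∀ {ψ} {t₁ u₁ t₂ u₂ t₃ u₃ t₄ u₄ : PTerm Γ} →
                 Δ ⊢ₚ t₁ ≼ u₁ → Δ ⊢ₚ t₂ ≼ u₂ → Δ ⊢ₚ t₃ ≼ u₃ → Δ ⊢ₚ t₄ ≼ u₄ →
                 (∀ {Δ'} → (∀ {φ} → Δ ⊢ₚ φ → Δ' ⊢ₚ wkF (wkF (wkF (wkF φ)))) →
                   Δ' ⊢ₚ W⁴ u₁ ≐ W⁴ t₁ ⊕ p3 → Δ' ⊢ₚ W⁴ u₂ ≐ W⁴ t₂ ⊕ p2 →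
                   Δ' ⊢ₚ W⁴ u₃ ≐ W⁴ t₃ ⊕ p1 → Δ' ⊢ₚ W⁴ u₄ ≐ W⁴ t₄ ⊕ p0 → Δ' ⊢ₚ wkF (wkF (wkF (wkF ψ)))) →
                 Δ ⊢ₚ ψ
  subtraction₄ h₁ h₂ h₃ h₄ k =
    ∃E (subtraction h₁) (∃E (subtraction (weakenCtx h₂)) (∃E (subtraction (weakenCtx (weakenCtx h₃)))
      (∃E (subtraction (weakenCtx (weakenCtx (weakenCtx h₄))))
        (k (λ d → weakenCtx (weakenCtx (weakenCtx (weakenCtx d))))
           (weakenCtx (weakenCtx (weakenCtx (hyp hd)))) (weakenCtx (weakenCtx (hyp hd))) (weakenCtx (hyp hd)) (hyp hd)))))

  module _ {X Y U V : Mat Γ} (dX : Δ ⊢ₚ Dom X) (dY : Δ ⊢ₚ Dom Y) (dU : Δ ⊢ₚ Dom U)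
           (H : Δ ⊢ₚ EqM (X ·ₘ Y) (U ·ₘ V)) (U⊆X : Δ ⊢ₚ cone U ⊆cone X) where

    editor-exists : ∀ {ψ} →
                    (∀ {Δ'} → Δ' ⊢ₚ Dom (fresh 𝔰) ∧' (EqM (W⁴ᵐ X ·ₘ fresh 𝔰) (W⁴ᵐ U) ∧' EqM (W⁴ᵐ Y) (fresh 𝔰 ·ₘ W⁴ᵐ V)) →
                      Δ' ⊢ₚ wkF (wkF (wkF (wkF ψ)))) →
                    Δ ⊢ₚ ψ
    editor-exists k =
      subtraction₄ (∧E₂ (∧E₁ U⊆X)) (∧E₂ (∧E₂ U⊆X)) (∧E₁ (∧E₁ U⊆X)) (∧E₁ (∧E₂ U⊆X))
        (λ ↑ e₁ e₂ e₃ e₄ → k (editor-witness (↑ dX) (↑ dY) (↑ dU) (↑ H) e₁ e₂ e₃ e₄))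

  editors : ∀ {A B C D : Mat Γ} → Δ ⊢ₚ Dom A → Δ ⊢ₚ Dom B → Δ ⊢ₚ Dom C → Δ ⊢ₚ Dom D →
            Δ ⊢ₚ EqM (A ·ₘ B) (C ·ₘ D) → Δ ⊢ₚ EditorGoal A B C D
  editors dA dB dC dD H = ∨E (cones-nest dA dB dC H)
    (editor-exists (weaken₁ dA) (weaken₁ dB) (weaken₁ dC) (weaken₁ H) (hyp hd)
       (λ w → reintroduce (EditorBody-left w)))
    (editor-exists (weaken₁ dC) (weaken₁ dD) (weaken₁ dA) (weaken₁ (EqM-sym H)) (hyp hd)
       (λ w → reintroduce (EditorBody-right w)))
    where
    reintroduce : ∀ {Γ'} {Δ' : List (PFormula (tt ∷ tt ∷ tt ∷ tt ∷ Γ'))} {A B C D : Mat Γ'} →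
                  Δ' ⊢ₚ EditorBody (fresh 𝔰) (W⁴ᵐ A) (W⁴ᵐ B) (W⁴ᵐ C) (W⁴ᵐ D) →
                  Δ' ⊢ₚ wkF (wkF (wkF (wkF (EditorGoal A B C D))))
    reintroduce {Δ' = Δ'} {A} {B} {C} {D} d = subst (Δ' ⊢ₚ_) (sym (EditorGoal-wkF⁴ A B C D)) (EditorGoal-intro p3 p2 p1 p0 d)

module Axioms where

  open import Data.List using ([]; _∷_)
  open import Data.Unit using (tt)
  open PAminusReasoning
  open PAminusOrder using (𝟙≰𝟘; ≐⇒≼)
  open Matrices
  open TranslationProperties using (skip; fresh)
  open EditorsAxiom using (editors)

  private
    ↑ᵐ : ∀ {Γ} → Mat Γ → Mat (tt ∷ tt ∷ tt ∷ tt ∷ Γ)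
    ↑ᵐ = renTr (skip 𝔰)

  opaque
    unfolding EditorsAxiom.EditorBody
    θ-axiom : ∀ {φ} → FUTC₁ φ → [] ⊢ₚ θ φ
    θ-axiom ax1 = ∀I (∀I (∀I (∀I (⇒I (∧I (I₂-·ₘ (EqM-refl I₂)) (·ₘ-I₂ (EqM-refl I₂)))))))
    θ-axiom ax2 = ∀I (∀I (∀I (∀I (⇒I (∀I (∀I (∀I (∀I (⇒I (⇒I
      (·ₘ≐I₂⇒≐I₂ (hyp (tl (tl hd))) (hyp (tl hd)) (hyp hd))))))))))))
    θ-axiom ax3 = ∀I (∀I (∀I (∀I (⇒I (∀I (∀I (∀I (∀I (⇒I (∀I (∀I (∀I (∀I (⇒I
      (·ₘ-assoc (↑ᵐ (↑ᵐ (fresh 𝔰))) (↑ᵐ (fresh 𝔰)) (fresh 𝔰))))))))))))))))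
    θ-axiom ax4 = ∀I (∧I
      (⇒I (𝟙≰𝟘 (≐⇒≼ (∧E₁ (∧E₂ (∧E₂ (hyp hd)))))))
      (∀I (∀I (∀I (∀I (⇒I (∀I (∀I (∀I (∀I (⇒I (⇒I
        (atom-irreducible (hyp (tl (tl hd))) (hyp (tl hd)) (∧E₁ (∧E₂ (∧E₂ (hyp hd)))))))))))))))))
    θ-axiom ax5 = ∀I (∀I (⇒I (∧E₁ (∧E₂ (hyp hd)))))
    θ-axiom ax6 = ∀I (∀I (∀I (∀I (⇒I (∀I (∀I (∀I (∀I (⇒I (∀I (∀I (∀I (∀I (⇒I (∀I (∀I (∀I (∀I (⇒I (⇒I
      (editors {A = ↑ᵐ (↑ᵐ (↑ᵐ (fresh 𝔰)))} {↑ᵐ (↑ᵐ (fresh 𝔰))} {↑ᵐ (fresh 𝔰)} {fresh 𝔰}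
         (hyp (tl (tl (tl (tl hd))))) (hyp (tl (tl (tl hd)))) (hyp (tl (tl hd))) (hyp (tl hd)) (hyp hd))))))))))))))))))))))
    θ-axiom ax7 = ∀I (∀I (∀I (∀I (⇒I (∀I (∀I (∀I (∀I (⇒I (⇒I (Fθ-injective (hyp hd))))))))))))

module Soundness where

  open import Data.List using (List; []; _∷_)
  open import Data.Product using (_,_)
  open import Relation.Binary.PropositionalEquality using (_≡_; refl; sym; trans; cong; subst)
  open PAminusReasoning
  open Matrices using (Dom-I₂; Dom-atom; Dom-·ₘ; EqM-refl)
  open TranslationProperties
  open MatrixRewriting
  open Axioms using (θ-axiom)
  open SyntaxProperties FUTCSig using () renaming (∈h-wkHyps⁻ to ∈h-FU-wkHyps⁻)

  record Faithful {Γ : List FSort} (Δ : List (FU.Formula Γ)) (Δ' : List (PFormula ⟦ Γ ⟧)) : Set where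
    field
      domain : (x : Γ FU.∋ 𝔰) → Δ' ⊢ₚ Dom (trVar x)
      hyps   : ∀ {ψ} → ψ FU.∈h Δ → Δ' ⊢ₚ θ ψ
  open Faithful

  Dom-trTerm : ∀ {Γ Δ Δ'} → Faithful {Γ} Δ Δ' → (t : FTerm Γ 𝔰) → Δ' ⊢ₚ Dom (trTerm t)
  Dom-trTerm F (FU.var x)                             = domain F x
  Dom-trTerm F (FU.app emp FU.nil)                    = Dom-I₂
  Dom-trTerm F (FU.app atom (t FU.∷ₜ FU.nil))         = Dom-atom (trTerm t)
  Dom-trTerm F (FU.app star (t FU.∷ₜ u FU.∷ₜ FU.nil)) = Dom-·ₘ (Dom-trTerm F t) (Dom-trTerm F u)

  assume : ∀ {Γ Δ Δ' φ} → Faithful {Γ} Δ Δ' → Δ' ⊢ₚ θ φ → Faithful (φ ∷ Δ) Δ'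
  domain (assume F d) = domain F
  hyps (assume F d) FU.hd     = d
  hyps (assume F d) (FU.tl h) = hyps F h

  weakenFaithful : ∀ {Γ Δ Δ' χ} → Faithful {Γ} Δ Δ' → Faithful Δ (χ ∷ Δ')
  domain (weakenFaithful F) x = weaken₁ (domain F x)
  hyps (weakenFaithful F) h   = weaken₁ (hyps F h)

  assumeθ : ∀ {Γ Δ Δ' φ} → Faithful {Γ} Δ Δ' → Faithful (φ ∷ Δ) (θ φ ∷ Δ')
  assumeθ F = assume (weakenFaithful F) (hyp hd)

  bind-𝔬 : ∀ {Γ Δ Δ' Θ} → Faithful {Γ} Δ Δ' → Δ' ⊆ʰ[ skip 𝔬 ] Θ → Faithful {𝔬 ∷ Γ} (FU.wkHyps Δ) Θ
  domain (bind-𝔬 F f) (FU.there x) = renameDeriv (skip 𝔬) f (domain F x)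
  hyps (bind-𝔬 F f) h with ∈h-FU-wkHyps⁻ h
  ... | ψ , h' , refl = subst (_ ⊢ₚ_) (sym (θ-wkF-𝔬 ψ)) (renameDeriv (skip 𝔬) f (hyps F h'))

  bind-𝔰 : ∀ {Γ Δ Δ' Θ} → Faithful {Γ} Δ Δ' → Δ' ⊆ʰ[ skip 𝔰 ] Θ → Θ ⊢ₚ Dom (mat p3 p2 p1 p0) →
           Faithful {𝔰 ∷ Γ} (FU.wkHyps Δ) Θ
  domain (bind-𝔰 F f d) FU.here      = d
  domain (bind-𝔰 F f d) (FU.there x) = renameDeriv (skip 𝔰) f (domain F x)
  hyps (bind-𝔰 F f d) h with ∈h-FU-wkHyps⁻ h
  ... | ψ , h' , refl = subst (_ ⊢ₚ_) (sym (θ-wkF-𝔰 ψ)) (renameDeriv (skip 𝔰) f (hyps F h'))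

  wkF⁴≡renF-skip : ∀ {Δ} (ψ : PFormula Δ) → wkF (wkF (wkF (wkF ψ))) ≡ renF (skip 𝔰) ψ
  wkF⁴≡renF-skip ψ =
    trans (cong (λ z → wkF (wkF z)) (renF-renF there there ψ)) (trans (cong wkF (renF-renF there _ ψ)) (renF-renF there _ ψ))

  ⊆ʰ-∀⁴ : ∀ {Δ} {Δ' : List (PFormula Δ)} {χ} → Δ' ⊆ʰ[ skip 𝔰 ] (χ ∷ wkHyps (wkHyps (wkHyps (wkHyps Δ'))))
  ⊆ʰ-∀⁴ {ψ = ψ} h = subst (_∈h _) (wkF⁴≡renF-skip ψ) (tl (∈h-wkHyps (∈h-wkHyps (∈h-wkHyps (∈h-wkHyps h)))))

  ⊆ʰ-∃⁴ : ∀ {Δ} {Δ' : List (PFormula Δ)} {χ₁ χ₂ χ₃ χ₄} →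
          Δ' ⊆ʰ[ skip 𝔰 ] (χ₁ ∷ wkHyps (χ₂ ∷ wkHyps (χ₃ ∷ wkHyps (χ₄ ∷ wkHyps Δ'))))
  ⊆ʰ-∃⁴ {ψ = ψ} h =
    subst (_∈h _) (wkF⁴≡renF-skip ψ) (tl (∈h-wkHyps (tl (∈h-wkHyps (tl (∈h-wkHyps (tl (∈h-wkHyps h))))))))

  translate : ∀ {Γ Δ φ} → FU.Deriv FUTC₁ Γ Δ φ → ∀ {Δ'} → Faithful Δ Δ' → Δ' ⊢ₚ θ φ
  translate (FU.hyp h) F              = hyps F h
  translate (FU.axm {φ} a) F          = subst (_ ⊢ₚ_) (sym (θ-closeF φ)) (renameDeriv (λ ()) (λ ()) (θ-axiom a))
  translate (FU.⊥E d) F               = ⊥E (translate d F)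
  translate (FU.raa d) F              = raa (translate d (assumeθ F))
  translate (FU.⇒I d) F               = ⇒I (translate d (assumeθ F))
  translate (FU.⇒E d e) F             = ⇒E (translate d F) (translate e F)
  translate (FU.∧I d e) F             = ∧I (translate d F) (translate e F)
  translate (FU.∧E₁ d) F              = ∧E₁ (translate d F)
  translate (FU.∧E₂ d) F              = ∧E₂ (translate d F)
  translate (FU.∨I₁ d) F              = ∨I₁ (translate d F)
  translate (FU.∨I₂ d) F              = ∨I₂ (translate d F)
  translate (FU.∨E d e₁ e₂) F         = ∨E (translate d F) (translate e₁ (assumeθ F)) (translate e₂ (assumeθ F))
  translate (FU.∀I {σ = 𝔬} d) F       = ∀I (translate d (bind-𝔬 F ∈h-wkHyps))
  translate (FU.∀I {σ = 𝔰} d) F       = ∀I (∀I (∀I (∀I (⇒I (translate d (bind-𝔰 F ⊆ʰ-∀⁴ (hyp hd)))))))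
  translate (FU.∀E {σ = 𝔬} {φ} d t) F = subst (_ ⊢ₚ_) (sym (θ-sub0-𝔬 t φ)) (∀E (translate d F) (trTerm t))
  translate (FU.∀E {σ = 𝔰} {φ} d t) F =
    subst (_ ⊢ₚ_) (sym (θ-sub0-𝔰 t φ)) (⇒E (∀E₄ (translate d F) _ _ _ _) (Dom-trTerm F t))
  translate (FU.∃I {σ = 𝔬} {φ} t d) F = ∃I (trTerm t) (subst (_ ⊢ₚ_) (θ-sub0-𝔬 t φ) (translate d F))
  translate (FU.∃I {σ = 𝔰} {φ} t d) F =
    ∃I₄ _ _ _ _ (∧I (Dom-trTerm F t) (subst (_ ⊢ₚ_) (θ-sub0-𝔰 t φ) (translate d F)))
  translate (FU.∃E {σ = 𝔬} {ψ = ψ} d e) F =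
    ∃E (translate d F) (subst (_ ⊢ₚ_) (θ-wkF-𝔬 ψ) (translate e (assume (bind-𝔬 F (λ h → tl (∈h-wkHyps h))) (hyp hd))))
  translate (FU.∃E {σ = 𝔰} {ψ = ψ} d e) F =
    ∃E (translate d F) (∃E (hyp hd) (∃E (hyp hd) (∃E (hyp hd)
      (subst (_ ⊢ₚ_) (trans (θ-wkF-𝔰 ψ) (sym (wkF⁴≡renF-skip (θ ψ))))
        (translate e (assume (bind-𝔰 F ⊆ʰ-∃⁴ (∧E₁ (hyp hd))) (∧E₂ (hyp hd))))))))
  translate (FU.≐refl {𝔬} t) F        = ≐refl (trTerm t)
  translate (FU.≐refl {𝔰} t) F        = EqM-refl (trTerm t)
  translate (FU.≐subst {𝔬} {t} {u} φ e d) F =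
    subst (_ ⊢ₚ_) (sym (θ-sub0-𝔬 u φ)) (≐subst (θ φ) (translate e F) (subst (_ ⊢ₚ_) (θ-sub0-𝔬 t φ) (translate d F)))
  translate (FU.≐subst {𝔰} {t} {u} φ e d) F =
    subst (_ ⊢ₚ_) (sym (θ-sub0-𝔰 u φ)) (≐subst-mat (θ φ) (translate e F) (subst (_ ⊢ₚ_) (θ-sub0-𝔰 t φ) (translate d F)))

  noAssumptions : Faithful {[]} [] []
  domain noAssumptions ()
  hyps noAssumptions ()

open Soundness using (translate; noAssumptions)

mainTheorem1 : (ψ : FU.Sentence) → FU._⊢_ FUTC₁ ψ → PA._⊢_ PAminus (θ ψ)
mainTheorem1 ψ d = translate d noAssumptions
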